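{- Let $n\ge 2$, let $q$ be a prime power, and let $\ell_1,\ell_2,\ell_3$ be three distinct $1$-dimensional linear subspaces of $\mathbb{F}_q^{\,n}$ that are coplanar, i.e. contained in a common $2$-dimensional subspace. Then the set of affine lines $\mathcal{L}(\ell_1)\sqcup\mathcal{L}(\ell_2)\sqcup\mathcal{L}(\ell_3)$ admits a universal cycle containing the vertex $0$.
   Context: Affine lines of $\mathbb{F}_q^{\,n}$ are the sets $x+\ell$ with $x\in\mathbb{F}_q^{\,n}$ and $\ell$ a $1$-dimensional linear subspace (the direction). For a $1$-dimensional subspace $\ell$, $\mathcal{L}(\ell)=\{x+\ell: x\in\mathbb{F}_q^{\,n}\}$ is the set of all affine lines with direction $\ell$. The projective completion $\mathrm{PG}(n,q)$ consists of the affine points $x\in\mathbb{F}_q^{\,n}$ and the points at infinity $[\ell]$, one for each $1$-dimensional subspace $\ell$. A window $(p,p')$ of two points of $\mathrm{PG}(n,q)$ represents an affine line as follows: if $p,p'$ are distinct affine points, the line through them; if one is an affine point $x$ and the other is $[\ell]$, the line $x+\ell$; otherwise it represents no affine line. Given a set $\mathcal{F}$ of affine lines, a universal cycle for $\mathcal{F}$ is a cyclic sequence $(p_i)_{i\in\mathbb{Z}/N\mathbb{Z}}$ of points of $\mathrm{PG}(n,q)$ such that every window $(p_i,p_{i+1})$ represents an affine line, the lines represented by the $N$ windows are pairwise distinct, and the set of lines represented is exactly $\mathcal{F}$. A cycle contains the vertex $0$ if $p_i=0$ (the origin of $\mathbb{F}_q^{\,n}$) for some $i$. -}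

module Defs where

open import Level using (0ℓ)
open import Data.Nat using (ℕ; zero; suc; _≤_)
open import Data.Nat.DivMod using (_%_; m%n<n)
open import Data.Fin using (Fin; toℕ; fromℕ<)
open import Data.Vec using (Vec; map; zipWith; replicate)
open import Data.Product using (Σ; ∃; ∃-syntax; _×_; _,_)
open import Data.Sum using (_⊎_)
open import Relation.Nullary using (¬_)
open import Data.Empty using (⊥)
open import Relation.Binary.PropositionalEquality using (_≡_)
open import Algebra.Structures using (IsCommutativeRing)
open import Function.Bundles using (_↔_; _⇔_)

-- A finite field with q elements is a commutative ring
-- (with propositional equality) with 0 ≠ 1, in which every nonzero
-- element has a multiplicative inverse, and whose carrier is in
-- bijection with Fin q.  (Every such field is F_q, q a prime power,
-- and every prime power q arises; so quantifying over these records
-- is the same as quantifying over prime powers q and the field F_q.)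

record FiniteField : Set₁ where
  infixl 6 _+_
  infixl 7 _*_
  field
    Carrier  : Set
    _+_ _*_  : Carrier → Carrier → Carrier
    -_       : Carrier → Carrier
    0# 1#    : Carrier
    isCommutativeRing : IsCommutativeRing _≡_ _+_ _*_ -_ 0# 1#
    0≢1      : ¬ (0# ≡ 1#)
    inverse  : ∀ x → ¬ (x ≡ 0#) → ∃[ y ] (x * y ≡ 1#)
    q        : ℕ
    enum     : Carrier ↔ Fin q

module Geometry (F : FiniteField) (n : ℕ) where
  open FiniteField F

  Pt : Set
  Pt = Vec Carrier n

  zeroV : Pt
  zeroV = replicate n 0#

  _⊕_ : Pt → Pt → Pt
  _⊕_ = zipWith _+_

  _⊖_ : Pt → Pt → Pt
  u ⊖ v = zipWith _+_ u (map -_ v)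

  _·_ : Carrier → Pt → Pt
  c · v = map (c *_) v

  NonZeroV : Pt → Set
  NonZeroV d = ¬ (d ≡ zeroV)

  InSpan : Pt → Pt → Set
  InSpan d v = ∃[ t ] (v ≡ t · d)

  SameSpan : Pt → Pt → Set
  SameSpan d e = ∀ v → (InSpan d v ⇔ InSpan e v)

  record Line : Set where
    constructor mkLine
    field
      base   : Pt
      dir    : Pt
      dir≢0  : NonZeroV dir

  OnLine : Line → Pt → Set
  OnLine L p = ∃[ t ] (p ≡ Line.base L ⊕ (t · Line.dir L))

  SameLine : Line → Line → Set
  SameLine L M = ∀ p → (OnLine L p ⇔ OnLine M p)

  HasDirection : Line → Pt → Set
  HasDirection L d = SameSpan (Line.dir L) d

  -- points of PG(n,q): affine points and points at infinity [ℓ],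
  -- the latter given by a nonzero spanning vector of ℓ
  -- (two vectors with the same span give the same point at infinity;
  -- all notions below only depend on the span).
  data PPt : Set where
    aff : Pt → PPt
    inf : (d : Pt) → NonZeroV d → PPt

  Represents : PPt → PPt → Line → Set
  Represents (aff x) (aff y) L =
    Σ (NonZeroV (y ⊖ x)) λ nz → SameLine L (mkLine x (y ⊖ x) nz)
  Represents (aff x) (inf d nz) L = SameLine L (mkLine x d nz)
  Represents (inf d nz) (aff x) L = SameLine L (mkLine x d nz)
  Represents (inf _ _) (inf _ _) L = ⊥

  next : ∀ {m} → Fin (suc m) → Fin (suc m)
  next {m} i = fromℕ< (m%n<n (suc (toℕ i)) (suc m))

  -- a universal cycle for the family 𝓕 (a predicate on lines, meant up
  -- to SameLine): a cyclic sequence p_0..p_{N-1} (N = suc m) together with,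
  -- for every window, the line it represents, such that these lines are
  -- pairwise distinct, all lie in 𝓕, and every line of 𝓕 occurs.
  record UniversalCycle (𝓕 : Line → Set) : Set where
    field
      m     : ℕ
      seq   : Fin (suc m) → PPt
      line  : Fin (suc m) → Line
      rep   : ∀ i → Represents (seq i) (seq (next i)) (line i)
      distinct : ∀ i j → SameLine (line i) (line j) → i ≡ j
      inFam : ∀ i → 𝓕 (line i)
      cover : ∀ L → 𝓕 L → ∃[ i ] SameLine L (line i)

  ContainsZero : ∀ {𝓕} → UniversalCycle 𝓕 → Set
  ContainsZero U = ∃[ i ] (UniversalCycle.seq U i ≡ aff zeroV)

  Fam3 : Pt → Pt → Pt → Line → Set
  Fam3 d₁ d₂ d₃ L = HasDirection L d₁ ⊎ HasDirection L d₂ ⊎ HasDirection L d₃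

  LinIndep2 : Pt → Pt → Set
  LinIndep2 u v = ∀ a b → (a · u) ⊕ (b · v) ≡ zeroV → (a ≡ 0#) × (b ≡ 0#)

  InSpan2 : Pt → Pt → Pt → Set
  InSpan2 u v w = ∃[ a ] ∃[ b ] (w ≡ (a · u) ⊕ (b · v))

  Coplanar : Pt → Pt → Pt → Set
  Coplanar d₁ d₂ d₃ = ∃[ u ] ∃[ v ]
    (LinIndep2 u v × InSpan2 u v d₁ × InSpan2 u v d₂ × InSpan2 u v d₃)

module Submission where

-- A linear automorphism of F^n carries universal cycles to universal cycles, so after
-- rescaling d₁, d₂ to make d₃ = d₁ + d₂ and completing them to a basis, the directions
-- are E₁ = e₁, E₂ = e₂, E₃ = e₁ + e₂.  A line of direction E k is then determined by a
-- key: the value of a linear form vanishing on E k, and the last n - 2 coordinates.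
-- The cycle runs block by block, the blocks indexed by an enumeration of a coordinate
-- space.  Over F₂ each affine plane parallel to span{e₁, e₂} carries exactly six lines of
-- the family, and one block walks through them as ∞₂ (0,0) ∞₃ (0,1) ∞₁ (1,0).  For q ≥ 3
-- a scalar κ ∉ {0, 1} cuts the family into the sides of q^(n-1) triangles; a block walks
-- ∞ₐ, two vertices, ∞_b through the three sides of one triangle, and consecutive blocks
-- share their point at infinity.

open import Level using (0ℓ)
open import Defs
open import Data.Nat as ℕ using (ℕ; zero; suc; _%_; _^_; _≤_; s≤s; z≤n)
open import Data.Nat.Properties using (+-suc; *-mono-≤; ≤-trans)
open import Data.Nat.DivMod using (m<n⇒m%n≡m; n%n≡0)
open import Data.Nat.Tactic.RingSolver using (solve-∀)
open import Data.Integer as ℤ using (ℤ; -[1+_]; sign; ∣_∣; _◃_)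
import Data.Integer.Properties as ℤ
open import Data.Sign as Sign using (Sign)
open import Data.Maybe using (Maybe; just; nothing)
open import Data.Empty using (⊥-elim)
open import Data.Product using (Σ; _×_; _,_; proj₁; proj₂; ∃-syntax; uncurry)
open import Data.Product.Properties using (,-injective)
open import Data.Product.Function.NonDependent.Propositional using (_×-↔_)
open import Data.Sum using (_⊎_; inj₁; inj₂)
import Data.Sum as Sum
open import Data.Fin using (Fin; zero; suc; toℕ; fromℕ; inject₁; combine; punchOut; punchIn) renaming (_≟_ to _≟ᶠ_)
open import Data.Fin.Patterns using (0F; 1F; 2F; 3F; 4F; 5F)
open import Data.Fin.Properties
  using (toℕ-injective; toℕ-fromℕ<; toℕ-fromℕ; toℕ-inject₁; toℕ<n; toℕ-combine; *↔×; all?; any?; ¬∀⟶∃¬; punchIn-punchOut)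
open import Data.Fin.Permutation using (transpose)
open import Data.Fin.Relation.Unary.Top using (view; ‵fromℕ; ‵inject₁)
open import Data.Vec using (Vec; []; _∷_; head; tail; lookup; zipWith; map; replicate; insertAt; removeAt)
open import Data.Vec.Properties
  using ( ∷-injective; lookup-zipWith; lookup-map; lookup-replicate; tabulate∘lookup; tabulate-cong
        ; map-insertAt; insertAt-lookup; insertAt-punchIn; removeAt-punchOut; removeAt-insertAt; insertAt-removeAt)
open import Function using (_∘_)
open import Function.Bundles using (_⇔_; mk⇔; Equivalence; _↔_; Inverse; mk↔ₛ′)
open import Function.Properties.Equivalence using () renaming (refl to ⇔-refl; sym to ⇔-sym; trans to ⇔-trans)
open import Function.Properties.Inverse using (↔-sym; ↔-trans)
open import Relation.Nullary using (¬_; yes; no)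
open import Relation.Nullary.Decidable using (from-yes; _×-dec_; _→-dec_; ¬?)
open import Relation.Binary.Definitions using (DecidableEquality)
open import Relation.Binary.PropositionalEquality
open import Algebra.Bundles using (CommutativeRing)
open import Algebra.Solver.Ring.AlmostCommutativeRing
  using (AlmostCommutativeRing; fromCommutativeRing; _-Raw-AlmostCommutative⟶_)

head-tail-injective : ∀ {A : Set} {m} {u u′ : Vec A (suc m)} → head u ≡ head u′ → tail u ≡ tail u′ → u ≡ u′
head-tail-injective {u = _ ∷ _} {_ ∷ _} = cong₂ _∷_

zipWith-insertAt : ∀ {A B C : Set} {m} (f : A → B → C) (xs : Vec A m) (ys : Vec B m) k x y →
  zipWith f (insertAt xs k x) (insertAt ys k y) ≡ insertAt (zipWith f xs ys) k (f x y)
zipWith-insertAt f xs ys zero x y = refl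
zipWith-insertAt f (x′ ∷ xs) (y′ ∷ ys) (suc k) x y = cong (f x′ y′ ∷_) (zipWith-insertAt f xs ys k x y)

insertAt-replicate : ∀ {A : Set} {m} {x : A} k → insertAt (replicate m x) k x ≡ replicate (suc m) x
insertAt-replicate zero = refl
insertAt-replicate {m = suc m} (suc k) = cong (_ ∷_) (insertAt-replicate k)

module FieldTheory (F : FiniteField) where
  open FiniteField F public

  commutativeRing : CommutativeRing 0ℓ 0ℓ
  commutativeRing = record { isCommutativeRing = isCommutativeRing }

  open CommutativeRing commutativeRing public
    using ( +-assoc; +-comm; +-identityˡ; +-identityʳ; -‿inverseʳ
          ; *-assoc; *-comm; *-identityˡ; *-identityʳ; distribˡ; zeroˡ; zeroʳ; ring; semiring)
  open import Algebra.Properties.Ring ring public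
    using (-‿involutive; -‿distribˡ-*; -‿distribʳ-*; -0#≈0#; -‿+-comm; -1*x≈-x; +-cancelˡ; +-cancelʳ)
    renaming (x∙y⁻¹≈ε⇒x≈y to x-y≡0⇒x≡y)
  open import Algebra.Properties.Semiring.Mult.TCOptimised semiring
    using (1+×; ×-homo-+; ×1-homo-*) renaming (_×_ to _×ₙ_)

  infixl 6 _-_
  _-_ : Carrier → Carrier → Carrier
  x - y = x + - y

  -- The ring solver takes its coefficients from ℤ.  With the optimised _×ₙ_,
  -- ⟦ ℤ.+ 0 ⟧ᶻ and ⟦ ℤ.+ 1 ⟧ᶻ reduce to 0# and 1#, so the constants :0 and :1
  -- below denote 0# and 1# definitionally.
  ⟦_⟧ᶻ : ℤ → Carrier
  ⟦ ℤ.+ n ⟧ᶻ = n ×ₙ 1#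
  ⟦ -[1+ n ] ⟧ᶻ = - (suc n ×ₙ 1#)

  private
    ⊖-homo : ∀ m n → ⟦ m ℤ.⊖ n ⟧ᶻ ≡ m ×ₙ 1# - n ×ₙ 1#
    ⊖-homo zero zero = sym (trans (+-identityˡ _) -0#≈0#)
    ⊖-homo zero (suc n) = sym (+-identityˡ _)
    ⊖-homo (suc m) zero = sym (trans (cong ((suc m ×ₙ 1#) +_) -0#≈0#) (+-identityʳ _))
    ⊖-homo (suc m) (suc n) = begin
      ⟦ suc m ℤ.⊖ suc n ⟧ᶻ               ≡⟨ cong ⟦_⟧ᶻ (ℤ.[1+m]⊖[1+n]≡m⊖n m n) ⟩
      ⟦ m ℤ.⊖ n ⟧ᶻ                       ≡⟨ ⊖-homo m n ⟩
      a - b                              ≡⟨ cong (_- b) (+-identityˡ a) ⟨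
      0# + a - b                         ≡⟨ cong (λ z → z + a - b) (-‿inverseʳ 1#) ⟨
      1# - 1# + a - b                    ≡⟨ cong (_- b) (+-assoc 1# (- 1#) a) ⟩
      1# + (- 1# + a) - b                ≡⟨ cong (λ z → 1# + z - b) (+-comm (- 1#) a) ⟩
      1# + (a - 1#) - b                  ≡⟨ cong (_- b) (+-assoc 1# a (- 1#)) ⟨
      1# + a - 1# - b                    ≡⟨ +-assoc (1# + a) (- 1#) (- b) ⟩
      1# + a + (- 1# + - b)              ≡⟨ cong (1# + a +_) (-‿+-comm 1# b) ⟩
      1# + a - (1# + b)                  ≡⟨ cong₂ _-_ (1+× m 1#) (1+× n 1#) ⟨
      suc m ×ₙ 1# - suc n ×ₙ 1#            ∎
      where
      open ≡-Reasoning
      a = m ×ₙ 1#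
      b = n ×ₙ 1#

    +-homo : ∀ i j → ⟦ i ℤ.+ j ⟧ᶻ ≡ ⟦ i ⟧ᶻ + ⟦ j ⟧ᶻ
    +-homo (ℤ.+ m) (ℤ.+ n) = ×-homo-+ 1# m n
    +-homo (ℤ.+ m) -[1+ n ] = ⊖-homo m (suc n)
    +-homo -[1+ m ] (ℤ.+ n) = trans (⊖-homo n (suc m)) (+-comm _ _)
    +-homo -[1+ m ] -[1+ n ] = trans (cong -_ (trans eq (×-homo-+ 1# (suc m) (suc n)))) (sym (-‿+-comm _ _))
      where
      eq : suc (suc (m ℕ.+ n)) ×ₙ 1# ≡ (suc m ℕ.+ suc n) ×ₙ 1#
      eq = cong (λ k → suc k ×ₙ 1#) (sym (+-suc m n))

    signed : Sign → Carrier → Carrier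
    signed Sign.+ x = x
    signed Sign.- x = - x

    ◃-homo : ∀ s n → ⟦ s ◃ n ⟧ᶻ ≡ signed s (n ×ₙ 1#)
    ◃-homo Sign.- zero = sym -0#≈0#
    ◃-homo Sign.+ zero = refl
    ◃-homo Sign.- (suc n) = refl
    ◃-homo Sign.+ (suc n) = refl

    signed-abs : ∀ i → ⟦ i ⟧ᶻ ≡ signed (sign i) (∣ i ∣ ×ₙ 1#)
    signed-abs -[1+ n ] = refl
    signed-abs (ℤ.+ n) = refl

    signed-* : ∀ s t x y → signed (s Sign.* t) (x * y) ≡ signed s x * signed t y
    signed-* Sign.- Sign.- x y = trans (sym (-‿involutive _))
      (trans (cong -_ (-‿distribʳ-* x y)) (-‿distribˡ-* x (- y)))
    signed-* Sign.- Sign.+ x y = -‿distribˡ-* x y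
    signed-* Sign.+ Sign.- x y = -‿distribʳ-* x y
    signed-* Sign.+ Sign.+ x y = refl

    *-homo : ∀ i j → ⟦ i ℤ.* j ⟧ᶻ ≡ ⟦ i ⟧ᶻ * ⟦ j ⟧ᶻ
    *-homo i j = begin
      ⟦ s ◃ (∣ i ∣ ℕ.* ∣ j ∣) ⟧ᶻ                              ≡⟨ ◃-homo s (∣ i ∣ ℕ.* ∣ j ∣) ⟩
      signed s ((∣ i ∣ ℕ.* ∣ j ∣) ×ₙ 1#)                        ≡⟨ cong (signed s) (×1-homo-* ∣ i ∣ ∣ j ∣) ⟩
      signed s ((∣ i ∣ ×ₙ 1#) * (∣ j ∣ ×ₙ 1#))                   ≡⟨ signed-* (sign i) (sign j) _ _ ⟩
      signed (sign i) (∣ i ∣ ×ₙ 1#) * signed (sign j) (∣ j ∣ ×ₙ 1#) ≡⟨ cong₂ _*_ (signed-abs i) (signed-abs j) ⟨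
      ⟦ i ⟧ᶻ * ⟦ j ⟧ᶻ                                           ∎
      where
      open ≡-Reasoning
      s = sign i Sign.* sign j

    neg-homo : ∀ i → ⟦ ℤ.- i ⟧ᶻ ≡ - ⟦ i ⟧ᶻ
    neg-homo -[1+ n ] = sym (-‿involutive _)
    neg-homo (ℤ.+ zero) = sym -0#≈0#
    neg-homo (ℤ.+ suc n) = refl

    almostCommutativeRing : AlmostCommutativeRing 0ℓ 0ℓ
    almostCommutativeRing = fromCommutativeRing commutativeRing

    ℤ⟶F : ℤ.+-*-rawRing -Raw-AlmostCommutative⟶ almostCommutativeRing
    ℤ⟶F = record
      { ⟦_⟧ = ⟦_⟧ᶻ ; +-homo = +-homo ; *-homo = *-homo ; -‿homo = neg-homo
      ; 0-homo = refl ; 1-homo = refl }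

    ⟦⟧ᶻ-≟ : ∀ a b → Maybe (⟦ a ⟧ᶻ ≡ ⟦ b ⟧ᶻ)
    ⟦⟧ᶻ-≟ a b with a ℤ.≟ b
    ... | yes a≡b = just (cong ⟦_⟧ᶻ a≡b)
    ... | no _ = nothing

  open import Algebra.Solver.Ring ℤ.+-*-rawRing almostCommutativeRing ℤ⟶F ⟦⟧ᶻ-≟ public
    using (solve; _:=_; _:+_; _:*_; :-_; con; Polynomial)

  :0 :1 : ∀ {k} → Polynomial k
  :0 = con (ℤ.+ 0)
  :1 = con (ℤ.+ 1)

  open Inverse enum using (to; from; strictlyInverseʳ)

  infix 4 _≟_
  _≟_ : DecidableEquality Carrier
  x ≟ y with to x ≟ᶠ to y
  ... | yes p = yes (trans (sym (strictlyInverseʳ x)) (trans (cong from p) (strictlyInverseʳ y)))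
  ... | no ¬p = no (λ x≡y → ¬p (cong to x≡y))

  1≢0 : ¬ (1# ≡ 0#)
  1≢0 e = 0≢1 (sym e)

  infix 30 _⁻¹
  _⁻¹ : ∀ {x} → ¬ (x ≡ 0#) → Carrier
  x≢0 ⁻¹ = proj₁ (inverse _ x≢0)

  *-inverseʳ : ∀ {x} (x≢0 : ¬ (x ≡ 0#)) → x * x≢0 ⁻¹ ≡ 1#
  *-inverseʳ x≢0 = proj₂ (inverse _ x≢0)

  *-inverseˡ : ∀ {x} (x≢0 : ¬ (x ≡ 0#)) → x≢0 ⁻¹ * x ≡ 1#
  *-inverseˡ x≢0 = trans (*-comm _ _) (*-inverseʳ x≢0)

  *-cancelˡ : ∀ {x a b} → ¬ (x ≡ 0#) → x * a ≡ x * b → a ≡ b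
  *-cancelˡ {x} {a} {b} x≢0 xa≡xb = begin
    a                   ≡⟨ *-identityˡ a ⟨
    1# * a              ≡⟨ cong (_* a) (*-inverseˡ x≢0) ⟨
    x≢0 ⁻¹ * x * a      ≡⟨ *-assoc _ x a ⟩
    x≢0 ⁻¹ * (x * a)    ≡⟨ cong (x≢0 ⁻¹ *_) xa≡xb ⟩
    x≢0 ⁻¹ * (x * b)    ≡⟨ *-assoc _ x b ⟨
    x≢0 ⁻¹ * x * b      ≡⟨ cong (_* b) (*-inverseˡ x≢0) ⟩
    1# * b              ≡⟨ *-identityˡ b ⟩
    b                   ∎
    where open ≡-Reasoning

  affine-injective : ∀ {a} b → ¬ a ≡ 0# → ∀ {c c′} → a * c + b ≡ a * c′ + b → c ≡ c′
  affine-injective b a≢0 = *-cancelˡ a≢0 ∘ +-cancelʳ b _ _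

  affine-surjective : ∀ {a} b → (a≢0 : ¬ a ≡ 0#) → ∀ v → a * (a≢0 ⁻¹ * (v - b)) + b ≡ v
  affine-surjective {a} b a≢0 v = begin
    a * (a≢0 ⁻¹ * (v - b)) + b    ≡⟨ cong (_+ b) (*-assoc a _ (v - b)) ⟨
    a * a≢0 ⁻¹ * (v - b) + b      ≡⟨ cong (λ z → z * (v - b) + b) (*-inverseʳ a≢0) ⟩
    1# * (v - b) + b              ≡⟨ solve 2 (λ v b → :1 :* (v :+ :- b) :+ b := v) refl v b ⟩
    v                             ∎
    where open ≡-Reasoning

  -1≢0 : ¬ - 1# ≡ 0#
  -1≢0 -1≡0 = 1≢0 (trans (sym (-‿involutive 1#)) (trans (cong -_ -1≡0) -0#≈0#))

  x+c≢x : ∀ {x c} → ¬ c ≡ 0# → ¬ x + c ≡ x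
  x+c≢x {x} {c} c≢0 x+c≡x = c≢0 (+-cancelˡ x c 0# (trans x+c≡x (sym (+-identityʳ x))))

module AffineSpace (F : FiniteField) (n : ℕ) where
  open FieldTheory F
  open Geometry F n public

  ≡-by-lookup : ∀ {u v : Pt} → (∀ i → lookup u i ≡ lookup v i) → u ≡ v
  ≡-by-lookup {u} {v} h = trans (sym (tabulate∘lookup u)) (trans (tabulate-cong h) (tabulate∘lookup v))

  lookup-⊕ : ∀ u v i → lookup (u ⊕ v) i ≡ lookup u i + lookup v i
  lookup-⊕ u v i = lookup-zipWith _+_ i u v

  lookup-· : ∀ c v i → lookup (c · v) i ≡ c * lookup v i
  lookup-· c v i = lookup-map i (c *_) v

  lookup-⊖ : ∀ u v i → lookup (u ⊖ v) i ≡ lookup u i - lookup v i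
  lookup-⊖ u v i = trans (lookup-zipWith _+_ i u _) (cong (lookup u i +_) (lookup-map i -_ v))

  lookup-zeroV : ∀ i → lookup zeroV i ≡ 0#
  lookup-zeroV i = lookup-replicate i 0#

  ⊖-as-⊕ : ∀ u v → u ⊖ v ≡ u ⊕ ((- 1#) · v)
  ⊖-as-⊕ u v = ≡-by-lookup λ i → trans (lookup-⊖ u v i)
    (trans (cong (lookup u i +_) (sym (trans (lookup-· (- 1#) v i) (-1*x≈-x _))))
      (sym (lookup-⊕ u _ i)))

  ·-zeroˡ : ∀ v → 0# · v ≡ zeroV
  ·-zeroˡ v = ≡-by-lookup λ i → trans (lookup-· 0# v i) (trans (zeroˡ _) (sym (lookup-zeroV i)))

  ·-zeroʳ : ∀ c → c · zeroV ≡ zeroV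
  ·-zeroʳ c = ≡-by-lookup λ i →
    trans (lookup-· c zeroV i) (trans (cong (c *_) (lookup-zeroV i)) (trans (zeroʳ c) (sym (lookup-zeroV i))))

  ·-identityˡ : ∀ v → 1# · v ≡ v
  ·-identityˡ v = ≡-by-lookup λ i → trans (lookup-· 1# v i) (*-identityˡ _)

  ·-assoc : ∀ a b v → a · (b · v) ≡ (a * b) · v
  ·-assoc a b v = ≡-by-lookup λ i →
    trans (lookup-· a (b · v) i) (trans (cong (a *_) (lookup-· b v i)) (trans (sym (*-assoc a b _)) (sym (lookup-· (a * b) v i))))

  ⊕-identityʳ : ∀ v → v ⊕ zeroV ≡ v
  ⊕-identityʳ v = ≡-by-lookup λ i →
    trans (lookup-⊕ v zeroV i) (trans (cong (lookup v i +_) (lookup-zeroV i)) (+-identityʳ _))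

  ⊕-identityˡ : ∀ v → zeroV ⊕ v ≡ v
  ⊕-identityˡ v = ≡-by-lookup λ i →
    trans (lookup-⊕ zeroV v i) (trans (cong (_+ lookup v i) (lookup-zeroV i)) (+-identityˡ _))

  ·-distribˡ-⊕ : ∀ c u v → c · (u ⊕ v) ≡ (c · u) ⊕ (c · v)
  ·-distribˡ-⊕ c u v = ≡-by-lookup λ i → begin
    lookup (c · (u ⊕ v)) i                ≡⟨ trans (lookup-· c (u ⊕ v) i) (cong (c *_) (lookup-⊕ u v i)) ⟩
    c * (lookup u i + lookup v i)         ≡⟨ distribˡ c _ _ ⟩
    c * lookup u i + c * lookup v i       ≡⟨ trans (lookup-⊕ (c · u) (c · v) i)
                                                     (cong₂ _+_ (lookup-· c u i) (lookup-· c v i)) ⟨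
    lookup ((c · u) ⊕ (c · v)) i          ∎
    where open ≡-Reasoning

  ·-nonzero : ∀ {a v} → ¬ (a ≡ 0#) → NonZeroV v → NonZeroV (a · v)
  ·-nonzero {a} {v} a≢0 v≢0 av≡0 = v≢0 (begin
    v                     ≡⟨ ·-identityˡ v ⟨
    1# · v                ≡⟨ cong (_· v) (*-inverseˡ a≢0) ⟨
    (a≢0 ⁻¹ * a) · v      ≡⟨ ·-assoc _ a v ⟨
    a≢0 ⁻¹ · (a · v)      ≡⟨ cong (a≢0 ⁻¹ ·_) av≡0 ⟩
    a≢0 ⁻¹ · zeroV        ≡⟨ ·-zeroʳ _ ⟩
    zeroV                 ∎)
    where open ≡-Reasoning

  scalar≢0 : ∀ {a v} → NonZeroV (a · v) → ¬ (a ≡ 0#)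
  scalar≢0 {v = v} av≢0 a≡0 = av≢0 (trans (cong (_· v) a≡0) (·-zeroˡ v))

  sameSpan-sym : ∀ {d e} → SameSpan d e → SameSpan e d
  sameSpan-sym d~e v = ⇔-sym (d~e v)

  sameSpan-trans : ∀ {d e f} → SameSpan d e → SameSpan e f → SameSpan d f
  sameSpan-trans d~e e~f v = ⇔-trans (d~e v) (e~f v)

  sameSpan⇒multiple : ∀ {d e} → NonZeroV d → SameSpan d e → ∃[ l ] (¬ (l ≡ 0#) × d ≡ l · e)
  sameSpan⇒multiple {d} d≢0 d~e with Equivalence.to (d~e d) (1# , sym (·-identityˡ d))
  ... | l , d≡le = l , scalar≢0 (subst NonZeroV d≡le d≢0) , d≡le

  multiple⇒sameSpan : ∀ {d e} l → NonZeroV e → e ≡ l · d → SameSpan d e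
  multiple⇒sameSpan {d} l e≢0 refl v = mk⇔
    (λ (t , v≡td) → t * l≢0 ⁻¹ , trans v≡td (trans (cong (_· d) (sym t/l*l≡t)) (sym (·-assoc _ l d))))
    (λ (t , v≡tld) → t * l , trans v≡tld (·-assoc t l d))
    where
    l≢0 = scalar≢0 e≢0
    t/l*l≡t : ∀ {t} → t * l≢0 ⁻¹ * l ≡ t
    t/l*l≡t {t} = trans (*-assoc t _ l) (trans (cong (t *_) (*-inverseˡ l≢0)) (*-identityʳ t))

  ⊕-⊖-cancel : ∀ P w → (P ⊕ w) ⊖ P ≡ w
  ⊕-⊖-cancel P w = ≡-by-lookup λ i → begin
    lookup ((P ⊕ w) ⊖ P) i                   ≡⟨ lookup-⊖ (P ⊕ w) P i ⟩
    lookup (P ⊕ w) i - lookup P i            ≡⟨ cong (_- lookup P i) (lookup-⊕ P w i) ⟩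
    lookup P i + lookup w i - lookup P i     ≡⟨ solve 2 (λ p w → p :+ w :+ :- p := w) refl (lookup P i) (lookup w i) ⟩
    lookup w i                               ∎
    where open ≡-Reasoning

  ⊕-⊖-inverse : ∀ P x → P ⊕ (x ⊖ P) ≡ x
  ⊕-⊖-inverse P x = ≡-by-lookup λ i → begin
    lookup (P ⊕ (x ⊖ P)) i                   ≡⟨ lookup-⊕ P (x ⊖ P) i ⟩
    lookup P i + lookup (x ⊖ P) i            ≡⟨ cong (lookup P i +_) (lookup-⊖ x P i) ⟩
    lookup P i + (lookup x i - lookup P i)   ≡⟨ solve 2 (λ p x → p :+ (x :+ :- p) := x) refl (lookup P i) (lookup x i) ⟩
    lookup x i                               ∎
    where open ≡-Reasoning

  sameLine-≡ : ∀ {b b′ d d′} (d≢0 : NonZeroV d) (d′≢0 : NonZeroV d′) → b ≡ b′ → d ≡ d′ →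
    SameLine (mkLine b d d≢0) (mkLine b′ d′ d′≢0)
  sameLine-≡ _ _ refl refl _ = ⇔-refl

  onLine⇔inSpan : ∀ {P d x} {d≢0 : NonZeroV d} → OnLine (mkLine P d d≢0) x ⇔ InSpan d (x ⊖ P)
  onLine⇔inSpan {P} {d} {x} = mk⇔
    (λ (t , x≡P⊕td) → t , trans (cong (_⊖ P) x≡P⊕td) (⊕-⊖-cancel P (t · d)))
    (λ (t , x⊖P≡td) → t , trans (sym (⊕-⊖-inverse P x)) (cong (P ⊕_) x⊖P≡td))

  ·-sameSpan : ∀ {a d} → ¬ (a ≡ 0#) → NonZeroV d → SameSpan (a · d) d
  ·-sameSpan a≢0 d≢0 = sameSpan-sym (multiple⇒sameSpan _ (·-nonzero a≢0 d≢0) refl)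

  sameSpan⇒sameLine : ∀ P {d e} (d≢0 : NonZeroV d) (e≢0 : NonZeroV e) →
    SameSpan d e → SameLine (mkLine P d d≢0) (mkLine P e e≢0)
  sameSpan⇒sameLine P d≢0 e≢0 d~e x =
    ⇔-trans (onLine⇔inSpan {d≢0 = d≢0}) (⇔-trans (d~e (x ⊖ P)) (⇔-sym (onLine⇔inSpan {d≢0 = e≢0})))

  represents-chord : ∀ {P Q d} {d≢0 : NonZeroV d} → OnLine (mkLine P d d≢0) Q → ¬ (Q ≡ P) →
    Represents (aff P) (aff Q) (mkLine P d d≢0)
  represents-chord {P} {Q} {d} {d≢0} Q∈L Q≢P with Equivalence.to (onLine⇔inSpan {d≢0 = d≢0}) Q∈L
  ... | t , Q⊖P≡td = Q⊖P≢0 , sameSpan⇒sameLine P d≢0 Q⊖P≢0 (multiple⇒sameSpan t Q⊖P≢0 Q⊖P≡td)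
    where
    Q⊖P≢0 : NonZeroV (Q ⊖ P)
    Q⊖P≢0 Q⊖P≡0 = Q≢P (trans (sym (⊕-⊖-inverse P Q)) (trans (cong (P ⊕_) Q⊖P≡0) (⊕-identityʳ P)))

module LinearAutomorphisms (F : FiniteField) (n : ℕ) where
  open FieldTheory F
  open AffineSpace F n

  record LinearAutomorphism : Set where
    field
      to from : Pt → Pt
      to-from : ∀ x → to (from x) ≡ x
      from-to : ∀ x → from (to x) ≡ x
      to-⊕ : ∀ u v → to (u ⊕ v) ≡ to u ⊕ to v
      to-· : ∀ c v → to (c · v) ≡ c · to v

    to-injective : ∀ {x y} → to x ≡ to y → x ≡ y
    to-injective {x} {y} tx≡ty = trans (sym (from-to x)) (trans (cong from tx≡ty) (from-to y))

    to-zeroV : to zeroV ≡ zeroV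
    to-zeroV = trans (cong to (sym (·-zeroˡ zeroV))) (trans (to-· 0# zeroV) (·-zeroˡ _))

    to-nonzero : ∀ {d} → NonZeroV d → NonZeroV (to d)
    to-nonzero d≢0 td≡0 = d≢0 (to-injective (trans td≡0 (sym to-zeroV)))

    to-⊖ : ∀ u v → to (u ⊖ v) ≡ to u ⊖ to v
    to-⊖ u v = begin
      to (u ⊖ v)                ≡⟨ cong to (⊖-as-⊕ u v) ⟩
      to (u ⊕ ((- 1#) · v))     ≡⟨ to-⊕ u _ ⟩
      to u ⊕ to ((- 1#) · v)    ≡⟨ cong (to u ⊕_) (to-· (- 1#) v) ⟩
      to u ⊕ ((- 1#) · to v)    ≡⟨ ⊖-as-⊕ (to u) (to v) ⟨
      to u ⊖ to v               ∎
      where open ≡-Reasoning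

    inverseMap : LinearAutomorphism
    inverseMap = record
      { to = from ; from = to ; to-from = from-to ; from-to = to-from
      ; to-⊕ = λ u v → to-injective (trans (to-from (u ⊕ v))
                 (sym (trans (to-⊕ (from u) (from v)) (cong₂ _⊕_ (to-from u) (to-from v)))))
      ; to-· = λ c v → to-injective (trans (to-from (c · v))
                 (sym (trans (to-· c (from v)) (cong (c ·_) (to-from v)))))
      }

    mapLine : Line → Line
    mapLine (mkLine b d d≢0) = mkLine (to b) (to d) (to-nonzero d≢0)

    mapPPt : PPt → PPt
    mapPPt (aff x) = aff (to x)
    mapPPt (inf d d≢0) = inf (to d) (to-nonzero d≢0)

    onLine-map : ∀ L x → OnLine L x ⇔ OnLine (mapLine L) (to x)
    onLine-map (mkLine b d _) x = mk⇔
      (λ (t , x≡b⊕td) → t , trans (cong to x≡b⊕td) (trans (to-⊕ b _) (cong (to b ⊕_) (to-· t d))))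
      (λ (t , tx≡) → t , to-injective (trans tx≡ (sym (trans (to-⊕ b _) (cong (to b ⊕_) (to-· t d))))))

    onLine-map⁻ : ∀ L y → OnLine (mapLine L) y ⇔ OnLine L (from y)
    onLine-map⁻ L y = ⇔-sym (subst (λ z → OnLine L (from y) ⇔ OnLine (mapLine L) z) (to-from y) (onLine-map L (from y)))

    sameLine-map : ∀ L M → SameLine L M → SameLine (mapLine L) (mapLine M)
    sameLine-map L M L≈M y = ⇔-trans (onLine-map⁻ L y) (⇔-trans (L≈M (from y)) (⇔-sym (onLine-map⁻ M y)))

    sameLine-unmap : ∀ L M → SameLine (mapLine L) (mapLine M) → SameLine L M
    sameLine-unmap L M φL≈φM x = ⇔-trans (onLine-map L x) (⇔-trans (φL≈φM (to x)) (⇔-sym (onLine-map M x)))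

    inSpan-map⁻ : ∀ d y → InSpan (to d) y ⇔ InSpan d (from y)
    inSpan-map⁻ d y = mk⇔
      (λ (t , y≡t·td) → t , to-injective (trans (to-from y) (trans y≡t·td (sym (to-· t d)))))
      (λ (t , fy≡td) → t , trans (sym (to-from y)) (trans (cong to fy≡td) (to-· t d)))

    sameSpan-map : ∀ d e → SameSpan d e → SameSpan (to d) (to e)
    sameSpan-map d e d~e y = ⇔-trans (inSpan-map⁻ d y) (⇔-trans (d~e (from y)) (⇔-sym (inSpan-map⁻ e y)))

    represents-map : ∀ p p′ L → Represents p p′ L → Represents (mapPPt p) (mapPPt p′) (mapLine L)
    represents-map (aff x) (aff y) L (y⊖x≢0 , L≈xy) =
      ty⊖tx≢0 , λ z → ⇔-trans (sameLine-map L (mkLine x (y ⊖ x) y⊖x≢0) L≈xy z)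
                               (sameLine-≡ (to-nonzero y⊖x≢0) ty⊖tx≢0 refl (to-⊖ y x) z)
      where
      ty⊖tx≢0 : NonZeroV (to y ⊖ to x)
      ty⊖tx≢0 = subst NonZeroV (to-⊖ y x) (to-nonzero y⊖x≢0)
    represents-map (aff x) (inf d d≢0) L L≈xd = sameLine-map L (mkLine x d d≢0) L≈xd
    represents-map (inf d d≢0) (aff x) L L≈xd = sameLine-map L (mkLine x d d≢0) L≈xd


  transport : (φ : LinearAutomorphism) → ∀ {𝓕 𝓖 : Line → Set} →
    let open LinearAutomorphism in
    (∀ L → 𝓕 L → 𝓖 (mapLine φ L)) → (∀ L → 𝓖 L → 𝓕 (mapLine (inverseMap φ) L)) →
    Σ (UniversalCycle 𝓕) ContainsZero → Σ (UniversalCycle 𝓖) ContainsZero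
  transport φ {𝓕} {𝓖} 𝓕⇒𝓖 𝓖⇒𝓕 (U , i , Uᵢ≡0) = U′ , i , trans (cong mapPPt Uᵢ≡0) (cong aff to-zeroV)
    where
    open LinearAutomorphism φ
    module U = UniversalCycle U
    module φ⁻¹ = LinearAutomorphism inverseMap

    mapLine-inverse : ∀ L → SameLine L (mapLine (φ⁻¹.mapLine L))
    mapLine-inverse (mkLine b d d≢0) = sameLine-≡ d≢0 (to-nonzero (φ⁻¹.to-nonzero d≢0)) (sym (to-from b)) (sym (to-from d))

    U′ : UniversalCycle 𝓖
    U′ = record
      { m = U.m
      ; seq = mapPPt ∘ U.seq
      ; line = mapLine ∘ U.line
      ; rep = λ i → represents-map _ _ _ (U.rep i)
      ; distinct = λ i j φLᵢ≈φLⱼ → U.distinct i j (sameLine-unmap (U.line i) (U.line j) φLᵢ≈φLⱼ)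
      ; inFam = λ i → 𝓕⇒𝓖 _ (U.inFam i)
      ; cover = λ L 𝓖L → let (i , L′≈Lᵢ) = U.cover _ (𝓖⇒𝓕 L 𝓖L) in
          i , λ x → ⇔-trans (mapLine-inverse L x) (sameLine-map (φ⁻¹.mapLine L) (U.line i) L′≈Lᵢ x)
      }

  module _ (φ : LinearAutomorphism) {e₁ e₂ e₃ d₁ d₂ d₃ : Pt} where
    open LinearAutomorphism φ
    private module φ⁻¹ = LinearAutomorphism inverseMap

    transport-Fam3 : SameSpan (to e₁) d₁ → SameSpan (to e₂) d₂ → SameSpan (to e₃) d₃ →
      Σ (UniversalCycle (Fam3 e₁ e₂ e₃)) ContainsZero → Σ (UniversalCycle (Fam3 d₁ d₂ d₃)) ContainsZero
    transport-Fam3 φe₁~d₁ φe₂~d₂ φe₃~d₃ = transport φ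
      (λ L → Sum.map (forward L φe₁~d₁) (Sum.map (forward L φe₂~d₂) (forward L φe₃~d₃)))
      (λ L → Sum.map (backward L φe₁~d₁) (Sum.map (backward L φe₂~d₂) (backward L φe₃~d₃)))
      where
      forward : ∀ L {e d} → SameSpan (to e) d → HasDirection L e → HasDirection (mapLine L) d
      forward (mkLine _ dir _) {e} φe~d dir~e v = ⇔-trans (sameSpan-map dir e dir~e v) (φe~d v)
      backward : ∀ L {e d} → SameSpan (to e) d → HasDirection L d → HasDirection (φ⁻¹.mapLine L) e
      backward (mkLine _ dir _) {e} {d} φe~d dir~d v =
        ⇔-trans (φ⁻¹.sameSpan-map dir d dir~d v)
          (⇔-sym (subst (λ e′ → InSpan e′ v ⇔ InSpan (from d) v) (from-to e) (φ⁻¹.sameSpan-map _ d φe~d v)))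

-- Parameterised by F and n only because the cyclic successor next lives in Geometry F n.
module CyclicOrders (F : FiniteField) (n : ℕ) where
  open Geometry F n

  record CyclicOrder (S : Set) : Set where
    field
      m : ℕ
      position : S ↔ Fin (suc m)
      succ : S → S
      position-succ : ∀ s → Inverse.to position (succ s) ≡ next (Inverse.to position s)

  next-toℕ : ∀ {m} (i k : Fin (suc m)) → toℕ k ≡ suc (toℕ i) → next i ≡ k
  next-toℕ {m} i k k≡1+i = toℕ-injective (begin
    toℕ (next i)         ≡⟨ toℕ-fromℕ< _ ⟩
    suc (toℕ i) % suc m  ≡⟨ cong (_% suc m) k≡1+i ⟨
    toℕ k % suc m        ≡⟨ m<n⇒m%n≡m (toℕ<n k) ⟩
    toℕ k                ∎)
    where open ≡-Reasoning

  next-inject₁ : ∀ {m} (i : Fin m) → next (inject₁ i) ≡ suc i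
  next-inject₁ i = next-toℕ (inject₁ i) (suc i) (cong suc (sym (toℕ-inject₁ i)))

  next-fromℕ : ∀ m → next (fromℕ m) ≡ zero
  next-fromℕ m = toℕ-injective (trans (toℕ-fromℕ< _) (trans (cong (λ k → suc k % suc m) (toℕ-fromℕ m)) (n%n≡0 (suc m))))

  module _ {B′ W′ : ℕ} where
    nextSlot : Fin (suc B′) × Fin (suc W′) → Fin (suc B′) × Fin (suc W′)
    nextSlot (j , o) with view o
    ... | ‵fromℕ = next j , zero
    ... | ‵inject₁ o′ = j , suc o′

    combine-nextSlot : ∀ s → uncurry combine (nextSlot s) ≡ next (uncurry combine s)
    combine-nextSlot (j , o) with view o
    ... | ‵inject₁ o′ = sym (next-toℕ _ _ (begin
      toℕ (combine j (suc o′))                      ≡⟨ toℕ-combine j (suc o′) ⟩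
      suc W′ ℕ.* toℕ j ℕ.+ suc (toℕ o′)             ≡⟨ +-suc _ _ ⟩
      suc (suc W′ ℕ.* toℕ j ℕ.+ toℕ o′)             ≡⟨ cong (λ k → suc (_ ℕ.+ k)) (toℕ-inject₁ o′) ⟨
      suc (suc W′ ℕ.* toℕ j ℕ.+ toℕ (inject₁ o′))   ≡⟨ cong suc (toℕ-combine j (inject₁ o′)) ⟨
      suc (toℕ (combine j (inject₁ o′)))            ∎))
      where open ≡-Reasoning
    ... | ‵fromℕ with view j
    ...   | ‵inject₁ j′ = trans (cong (λ k → combine k zero) (next-inject₁ j′)) (sym (next-toℕ _ _ (begin
      toℕ (combine (suc j′) (zero {W′}))                  ≡⟨ toℕ-combine (suc j′) zero ⟩
      suc W′ ℕ.* suc (toℕ j′) ℕ.+ 0                       ≡⟨ arithmetic W′ (toℕ j′) ⟩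
      suc (suc W′ ℕ.* toℕ j′ ℕ.+ W′)
        ≡⟨ cong₂ (λ a b → suc (suc W′ ℕ.* a ℕ.+ b)) (toℕ-inject₁ j′) (toℕ-fromℕ W′) ⟨
      suc (suc W′ ℕ.* toℕ (inject₁ j′) ℕ.+ toℕ (fromℕ W′))
        ≡⟨ cong suc (toℕ-combine (inject₁ j′) (fromℕ W′)) ⟨
      suc (toℕ (combine (inject₁ j′) (fromℕ W′)))         ∎)))
      where
      open ≡-Reasoning
      arithmetic : ∀ w j → suc w ℕ.* suc j ℕ.+ 0 ≡ suc (suc w ℕ.* j ℕ.+ w)
      arithmetic = solve-∀
    ...   | ‵fromℕ = trans (cong (λ k → combine k zero) (next-fromℕ B′))
      (sym (trans (cong next last≡fromℕ) (next-fromℕ _)))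
      where
      last≡fromℕ : combine (fromℕ B′) (fromℕ W′) ≡ fromℕ (W′ ℕ.+ B′ ℕ.* suc W′)
      last≡fromℕ = toℕ-injective (begin
        toℕ (combine (fromℕ B′) (fromℕ W′))            ≡⟨ toℕ-combine (fromℕ B′) (fromℕ W′) ⟩
        suc W′ ℕ.* toℕ (fromℕ B′) ℕ.+ toℕ (fromℕ W′)
          ≡⟨ cong₂ (λ a b → suc W′ ℕ.* a ℕ.+ b) (toℕ-fromℕ B′) (toℕ-fromℕ W′) ⟩
        suc W′ ℕ.* B′ ℕ.+ W′                          ≡⟨ arithmetic W′ B′ ⟩
        W′ ℕ.+ B′ ℕ.* suc W′                          ≡⟨ toℕ-fromℕ _ ⟨
        toℕ (fromℕ (W′ ℕ.+ B′ ℕ.* suc W′))             ∎)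
        where
        open ≡-Reasoning
        arithmetic : ∀ w b → suc w ℕ.* b ℕ.+ w ≡ w ℕ.+ b ℕ.* suc w
        arithmetic = solve-∀

  blockOrder : ∀ B′ W′ → CyclicOrder (Fin (suc B′) × Fin (suc W′))
  blockOrder B′ W′ = record
    { m = W′ ℕ.+ B′ ℕ.* suc W′
    ; position = ↔-sym (*↔× {suc B′} {suc W′})
    ; succ = nextSlot
    ; position-succ = combine-nextSlot
    }

  module _ {S : Set} (O : CyclicOrder S) {𝓕 : Line → Set} (token : S → PPt) (line : S → Line) where
    open CyclicOrder O
    open Inverse position using (to; from; strictlyInverseˡ; strictlyInverseʳ)

    universalCycle :
      (∀ s → Represents (token s) (token (succ s)) (line s)) →
      (∀ s s′ → SameLine (line s) (line s′) → s ≡ s′) →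
      (∀ s → 𝓕 (line s)) →
      (∀ L → 𝓕 L → ∃[ s ] SameLine L (line s)) →
      ∃[ s ] token s ≡ aff zeroV →
      Σ (UniversalCycle 𝓕) ContainsZero
    universalCycle represents line-injective inFam cover (s₀ , s₀↦0) =
      U , to s₀ , trans (cong token (strictlyInverseʳ s₀)) s₀↦0
      where
      from-next : ∀ i → from (next i) ≡ succ (from i)
      from-next i = begin
        from (next i)             ≡⟨ cong (from ∘ next) (strictlyInverseˡ i) ⟨
        from (next (to (from i))) ≡⟨ cong from (position-succ (from i)) ⟨
        from (to (succ (from i))) ≡⟨ strictlyInverseʳ _ ⟩
        succ (from i)             ∎
        where open ≡-Reasoning
      U : UniversalCycle 𝓕
      U = record
        { m = m
        ; seq = token ∘ from
        ; line = line ∘ from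
        ; rep = λ i → subst (λ s → Represents (token (from i)) (token s) (line (from i))) (sym (from-next i)) (represents (from i))
        ; distinct = λ i j Lᵢ≈Lⱼ →
            trans (sym (strictlyInverseˡ i)) (trans (cong to (line-injective _ _ Lᵢ≈Lⱼ)) (strictlyInverseˡ j))
        ; inFam = λ i → inFam (from i)
        ; cover = λ L 𝓕L → let (s , L≈Lₛ) = cover L 𝓕L in
            to s , subst (λ s′ → SameLine L (line s′)) (sym (strictlyInverseʳ s)) L≈Lₛ
        }

vectors↔ : ∀ {A : Set} {q} → A ↔ Fin q → ∀ k → Vec A k ↔ Fin (q ^ k)
vectors↔ A↔q zero = mk↔ₛ′ (λ _ → zero) (λ _ → []) (λ { zero → refl }) (λ { [] → refl })
vectors↔ {A} A↔q (suc k) = ↔-trans uncons (↔-trans (A↔q ×-↔ vectors↔ A↔q k) (↔-sym *↔×))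
  where
  uncons : Vec A (suc k) ↔ (A × Vec A k)
  uncons = mk↔ₛ′ (λ { (x ∷ xs) → x , xs }) (uncurry _∷_) (λ _ → refl) (λ { (x ∷ xs) → refl })

centred : ∀ {A : Set} {N} (a : A) → Fin (suc N) ↔ A → Σ (Fin (suc N) ↔ A) λ e → Inverse.to e zero ≡ a
centred a e = ↔-trans (transpose zero (Inverse.from e a)) e , Inverse.strictlyInverseˡ e a

module Enumerations (F : FiniteField) where
  open FieldTheory F

  2≤q : 2 ≤ q
  2≤q = two-elements (to 0#) (to 1#) λ e → 0≢1 (trans (sym (strictlyInverseʳ 0#)) (trans (cong from e) (strictlyInverseʳ 1#)))
    where
    open Inverse enum
    two-elements : ∀ {N} (a b : Fin N) → ¬ a ≡ b → 2 ≤ N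
    two-elements {suc zero} zero zero a≢b = ⊥-elim (a≢b refl)
    two-elements {suc (suc N)} _ _ _ = s≤s (s≤s z≤n)

  1≤q^ : ∀ k → 1 ≤ q ^ k
  1≤q^ zero = s≤s z≤n
  1≤q^ (suc k) = *-mono-≤ (≤-trans (s≤s z≤n) 2≤q) (1≤q^ k)

  private
    enumeration : ∀ k {N} → q ^ k ≡ suc N → Σ (Fin (suc N) ↔ Vec Carrier k) λ e → Inverse.to e zero ≡ replicate k 0#
    enumeration k q^k≡1+N = centred (replicate k 0#) (subst (λ N → Fin N ↔ Vec Carrier k) q^k≡1+N (↔-sym (vectors↔ enum k)))

  centredEnumeration : ∀ k → ∃[ B′ ] Σ (Fin (suc B′) ↔ Vec Carrier k) λ e → Inverse.to e zero ≡ replicate k 0#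
  centredEnumeration k = let B′ , q^k≡1+B′ = positive (1≤q^ k) in B′ , enumeration k q^k≡1+B′
    where
    positive : ∀ {N} → 1 ≤ N → ∃[ N′ ] N ≡ suc N′
    positive (s≤s _) = _ , refl

  centredEnumeration⁺ : ∀ k →
    ∃[ B″ ] Σ (Fin (suc (suc B″)) ↔ Vec Carrier (suc k)) λ e → Inverse.to e zero ≡ replicate (suc k) 0#
  centredEnumeration⁺ k = let B″ , q^k≡2+B″ = at-least-two (*-mono-≤ 2≤q (1≤q^ k)) in B″ , enumeration (suc k) q^k≡2+B″
    where
    at-least-two : ∀ {N} → 2 ≤ N → ∃[ N′ ] N ≡ suc (suc N′)
    at-least-two (s≤s (s≤s _)) = _ , refl

Dir : Set
Dir = Fin 3

pattern D₁ = zero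
pattern D₂ = suc zero
pattern D₃ = suc (suc zero)

-- Junk on the diagonal a ≡ b.
third : Dir → Dir → Dir
third D₁ D₂ = D₃
third D₂ D₁ = D₃
third D₁ D₃ = D₂
third D₃ D₁ = D₂
third _ _ = D₁

third≢ˡ : ∀ a b → ¬ a ≡ b → ¬ third a b ≡ a
third≢ˡ = from-yes (all? λ a → all? λ b → ¬? (a ≟ᶠ b) →-dec ¬? (third a b ≟ᶠ a))

third≢ʳ : ∀ a b → ¬ a ≡ b → ¬ third a b ≡ b
third≢ʳ = from-yes (all? λ a → all? λ b → ¬? (a ≟ᶠ b) →-dec ¬? (third a b ≟ᶠ b))

-- A triangle block from hub a to hub b has three windows, of directions a, third a b
-- and b, through the vertices b, b and a of its triangle.
slotDir : Dir → Dir → Fin 3 → Dir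
slotDir a b = lookup (a ∷ third a b ∷ b ∷ [])

slotCorner : Dir → Dir → Fin 3 → Dir
slotCorner a b = lookup (b ∷ b ∷ a ∷ [])

slotDir-injective : ∀ a b → ¬ a ≡ b → ∀ o o′ → slotDir a b o ≡ slotDir a b o′ → o ≡ o′
slotDir-injective = from-yes (all? λ a → all? λ b → ¬? (a ≟ᶠ b) →-dec
  all? λ o → all? λ o′ → (slotDir a b o ≟ᶠ slotDir a b o′) →-dec (o ≟ᶠ o′))

slotDir-surjective : ∀ a b → ¬ a ≡ b → ∀ k → ∃[ o ] slotDir a b o ≡ k
slotDir-surjective = from-yes (all? λ a → all? λ b → ¬? (a ≟ᶠ b) →-dec
  all? λ k → any? λ o → slotDir a b o ≟ᶠ k)

slotDir≢slotCorner : ∀ a b → ¬ a ≡ b → ∀ o → ¬ slotDir a b o ≡ slotCorner a b o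
slotDir≢slotCorner = from-yes (all? λ a → all? λ b → ¬? (a ≟ᶠ b) →-dec
  all? λ o → ¬? (slotDir a b o ≟ᶠ slotCorner a b o))

alternate : ℕ → Dir
alternate zero = D₁
alternate (suc zero) = D₂
alternate (suc (suc k)) = alternate k

alternate≢D₃ : ∀ k → ¬ alternate k ≡ D₃
alternate≢D₃ zero ()
alternate≢D₃ (suc zero) ()
alternate≢D₃ (suc (suc k)) = alternate≢D₃ k

alternate-step : ∀ k → ¬ alternate k ≡ alternate (suc k)
alternate-step zero ()
alternate-step (suc zero) ()
alternate-step (suc (suc k)) = alternate-step k

-- Consecutive hubs differ, and for any number ≥ 2 of blocks so do the last and the
-- first, since alternate avoids D₃.
hub : ℕ → Dir
hub zero = D₃
hub (suc k) = alternate k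

hub-step : ∀ k → ¬ hub k ≡ hub (suc k)
hub-step zero D₃≡alt = alternate≢D₃ zero (sym D₃≡alt)
hub-step (suc k) = alternate-step k

module StandardPlane (F : FiniteField) (n′ : ℕ) where
  open FieldTheory F
  open AffineSpace F (suc (suc n′)) public
  open CyclicOrders F (suc (suc n′)) public
  private module Tail = AffineSpace F n′

  E : Dir → Pt
  E D₁ = 1# ∷ 0# ∷ Tail.zeroV
  E D₂ = 0# ∷ 1# ∷ Tail.zeroV
  E D₃ = 1# ∷ 1# ∷ Tail.zeroV

  E-nonzero : ∀ k → NonZeroV (E k)
  E-nonzero D₁ e = 1≢0 (proj₁ (∷-injective e))
  E-nonzero D₂ e = 1≢0 (proj₁ (∷-injective (proj₂ (∷-injective e))))
  E-nonzero D₃ e = 1≢0 (proj₁ (∷-injective e))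

  stdLine : Dir → Pt → Line
  stdLine k P = mkLine P (E k) (E-nonzero k)

  Fam : Line → Set
  Fam = Fam3 (E D₁) (E D₂) (E D₃)

  -- σ k is a linear form in the first two coordinates whose kernel there is spanned by
  -- E k, so the line of direction E k through x is determined by key k x.
  σ : Dir → Pt → Carrier
  σ D₁ (s ∷ t ∷ _) = t
  σ D₂ (s ∷ t ∷ _) = s
  σ D₃ (s ∷ t ∷ _) = s - t

  Key : Set
  Key = Carrier × Vec Carrier n′

  key : Dir → Pt → Key
  key k x = σ k x , tail (tail x)

  tail-fixed : ∀ τ (r : Vec Carrier n′) → r Tail.⊕ (τ Tail.· Tail.zeroV) ≡ r
  tail-fixed τ r = trans (cong (r Tail.⊕_) (Tail.·-zeroʳ τ)) (Tail.⊕-identityʳ r)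

  onStdLine : ∀ k P x → OnLine (stdLine k P) x ⇔ key k x ≡ key k P
  onStdLine k (s ∷ t ∷ r) (s′ ∷ t′ ∷ r′) = mk⇔ (along k) (back k)
    where
    P = s ∷ t ∷ r
    x = s′ ∷ t′ ∷ r′
    split : ∀ {a b} {u : Vec Carrier n′} → x ≡ a ∷ b ∷ u → s′ ≡ a × t′ ≡ b × r′ ≡ u
    split refl = refl , refl , refl
    along : ∀ k → OnLine (stdLine k P) x → key k x ≡ key k P
    along D₁ (τ , e) with split e
    ... | _ , t′≡ , r′≡ =
      cong₂ _,_ (trans t′≡ (solve 2 (λ t τ → t :+ τ :* :0 := t) refl t τ)) (trans r′≡ (tail-fixed τ r))
    along D₂ (τ , e) with split e
    ... | s′≡ , _ , r′≡ =
      cong₂ _,_ (trans s′≡ (solve 2 (λ s τ → s :+ τ :* :0 := s) refl s τ)) (trans r′≡ (tail-fixed τ r))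
    along D₃ (τ , e) with split e
    ... | s′≡ , t′≡ , r′≡ = cong₂ _,_
      (trans (cong₂ _-_ s′≡ t′≡) (solve 3 (λ s t τ → (s :+ τ :* :1) :+ :- (t :+ τ :* :1) := s :+ :- t) refl s t τ))
      (trans r′≡ (tail-fixed τ r))
    back : ∀ k → key k x ≡ key k P → OnLine (stdLine k P) x
    back D₁ e with ,-injective e
    ... | t′≡t , refl = s′ - s , cong₂ _∷_ (solve 2 (λ s s′ → s′ := s :+ (s′ :+ :- s) :* :1) refl s s′)
      (cong₂ _∷_ (trans t′≡t (solve 2 (λ t τ → t := t :+ τ :* :0) refl t (s′ - s))) (sym (tail-fixed (s′ - s) r′)))
    back D₂ e with ,-injective e
    ... | s′≡s , refl = t′ - t , cong₂ _∷_ (trans s′≡s (solve 2 (λ s τ → s := s :+ τ :* :0) refl s (t′ - t)))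
      (cong₂ _∷_ (solve 2 (λ t t′ → t′ := t :+ (t′ :+ :- t) :* :1) refl t t′) (sym (tail-fixed (t′ - t) r′)))
    back D₃ e with ,-injective e
    ... | s′-t′≡s-t , refl = s′ - s , cong₂ _∷_ (solve 2 (λ s s′ → s′ := s :+ (s′ :+ :- s) :* :1) refl s s′)
      (cong₂ _∷_ t′≡ (sym (tail-fixed (s′ - s) r′)))
      where
      t′≡ : t′ ≡ t + (s′ - s) * 1#
      t′≡ = begin
        t′                  ≡⟨ solve 2 (λ s′ t′ → t′ := s′ :+ :- (s′ :+ :- t′)) refl s′ t′ ⟩
        s′ - (s′ - t′)      ≡⟨ cong (λ z → s′ - z) s′-t′≡s-t ⟩
        s′ - (s - t)        ≡⟨ solve 3 (λ s t s′ → s′ :+ :- (s :+ :- t) := t :+ (s′ :+ :- s) :* :1) refl s t s′ ⟩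
        t + (s′ - s) * 1#   ∎
        where open ≡-Reasoning

  stdLine-cong : ∀ k {P P′} → key k P ≡ key k P′ → SameLine (stdLine k P) (stdLine k P′)
  stdLine-cong k {P} {P′} P~P′ x = ⇔-trans (onStdLine k P x)
    (⇔-trans (mk⇔ (λ e → trans e P~P′) (λ e → trans e (sym P~P′))) (⇔-sym (onStdLine k P′ x)))

  σ-⊕ : ∀ k x v → σ k (x ⊕ v) ≡ σ k x + σ k v
  σ-⊕ D₁ (_ ∷ _ ∷ _) (_ ∷ _ ∷ _) = refl
  σ-⊕ D₂ (_ ∷ _ ∷ _) (_ ∷ _ ∷ _) = refl
  σ-⊕ D₃ (s ∷ t ∷ _) (s′ ∷ t′ ∷ _) =
    solve 4 (λ s t s′ t′ → s :+ s′ :+ :- (t :+ t′) := s :+ :- t :+ (s′ :+ :- t′)) refl s t s′ t′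

  σ-E≡0 : ∀ a b → σ b (E a) ≡ 0# → a ≡ b
  σ-E≡0 D₁ D₁ _ = refl
  σ-E≡0 D₂ D₂ _ = refl
  σ-E≡0 D₃ D₃ _ = refl
  σ-E≡0 D₂ D₁ 1≡0 = ⊥-elim (1≢0 1≡0)
  σ-E≡0 D₃ D₁ 1≡0 = ⊥-elim (1≢0 1≡0)
  σ-E≡0 D₁ D₂ 1≡0 = ⊥-elim (1≢0 1≡0)
  σ-E≡0 D₃ D₂ 1≡0 = ⊥-elim (1≢0 1≡0)
  σ-E≡0 D₁ D₃ 1-0≡0 = ⊥-elim (1≢0 (trans (solve 0 (:1 := :1 :+ :- :0) refl) 1-0≡0))
  σ-E≡0 D₂ D₃ 0-1≡0 = ⊥-elim (1≢0 (trans (solve 0 (:1 := :- (:0 :+ :- :1)) refl) (trans (cong -_ 0-1≡0) -0#≈0#)))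

  onStdLine-base : ∀ k P → OnLine (stdLine k P) P
  onStdLine-base k P = 0# , sym (trans (cong (P ⊕_) (·-zeroˡ (E k))) (⊕-identityʳ P))

  stdLine-injective : ∀ a b P P′ → SameLine (stdLine a P) (stdLine b P′) → a ≡ b × key b P ≡ key b P′
  stdLine-injective a b P P′ La≈Lb = σ-E≡0 a b σb[Ea]≡0 , key-P
    where
    key-on-La : ∀ Q → OnLine (stdLine a P) Q → key b Q ≡ key b P′
    key-on-La Q Q∈La = Equivalence.to (onStdLine b P′ Q) (Equivalence.to (La≈Lb Q) Q∈La)
    key-P : key b P ≡ key b P′
    key-P = key-on-La P (onStdLine-base a P)
    σb[Ea]≡0 : σ b (E a) ≡ 0#
    σb[Ea]≡0 = begin
      σ b (E a)                             ≡⟨ solve 2 (λ p e → e := p :+ e :+ :- p) refl (σ b P) (σ b (E a)) ⟩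
      σ b P + σ b (E a) - σ b P             ≡⟨ cong (λ z → σ b P + σ b z - σ b P) (·-identityˡ (E a)) ⟨
      σ b P + σ b (1# · E a) - σ b P        ≡⟨ cong (_- σ b P) (σ-⊕ b P (1# · E a)) ⟨
      σ b (P ⊕ (1# · E a)) - σ b P          ≡⟨ cong (λ ℓ → proj₁ ℓ - σ b P) (trans (key-on-La (P ⊕ (1# · E a)) (1# , refl)) (sym key-P)) ⟩
      σ b P - σ b P                         ≡⟨ -‿inverseʳ (σ b P) ⟩
      0#                                    ∎
      where open ≡-Reasoning

  hasDirection⇒stdLine : ∀ k L → HasDirection L (E k) → SameLine L (stdLine k (Line.base L))
  hasDirection⇒stdLine k (mkLine P d d≢0) = sameSpan⇒sameLine P d≢0 (E-nonzero k)

  represents-inf-aff : ∀ k P → Represents (inf (E k) (E-nonzero k)) (aff P) (stdLine k P)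
  represents-inf-aff k P _ = ⇔-refl

  represents-aff-inf : ∀ k P → Represents (aff P) (inf (E k) (E-nonzero k)) (stdLine k P)
  represents-aff-inf k P _ = ⇔-refl

  represents-aff-aff : ∀ k P Q → key k Q ≡ key k P → ¬ Q ≡ P → Represents (aff P) (aff Q) (stdLine k P)
  represents-aff-aff k P Q Q~P = represents-chord {d≢0 = E-nonzero k} (Equivalence.from (onStdLine k P Q) Q~P)

  record StandardSchedule {S : Set} (O : CyclicOrder S) : Set where
    open CyclicOrder O using (succ)
    field
      token : S → PPt
      dir : S → Dir
      base : S → Pt
      represents : ∀ s → Represents (token s) (token (succ s)) (stdLine (dir s) (base s))
      label-injective : ∀ s s′ → dir s ≡ dir s′ → key (dir s) (base s) ≡ key (dir s) (base s′) → s ≡ s′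
      label-surjective : ∀ k ℓ → ∃[ s ] (dir s ≡ k × key k (base s) ≡ ℓ)
      visits-origin : ∃[ s ] token s ≡ aff zeroV

  Fam-std : ∀ k P → Fam (stdLine k P)
  Fam-std D₁ P = inj₁ λ _ → ⇔-refl
  Fam-std D₂ P = inj₂ (inj₁ λ _ → ⇔-refl)
  Fam-std D₃ P = inj₂ (inj₂ λ _ → ⇔-refl)

  Fam-direction : ∀ L → Fam L → ∃[ k ] HasDirection L (E k)
  Fam-direction L (inj₁ L∥E₁) = D₁ , L∥E₁
  Fam-direction L (inj₂ (inj₁ L∥E₂)) = D₂ , L∥E₂
  Fam-direction L (inj₂ (inj₂ L∥E₃)) = D₃ , L∥E₃

  standardCycle : ∀ {S} {O : CyclicOrder S} → StandardSchedule O → Σ (UniversalCycle Fam) ContainsZero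
  standardCycle {S} {O} schedule =
    universalCycle O token line represents line-injective (λ s → Fam-std (dir s) (base s)) cover visits-origin
    where
    open StandardSchedule schedule
    line : S → Line
    line s = stdLine (dir s) (base s)
    line-injective : ∀ s s′ → SameLine (line s) (line s′) → s ≡ s′
    line-injective s s′ Lₛ≈Lₛ′ with stdLine-injective (dir s) (dir s′) (base s) (base s′) Lₛ≈Lₛ′
    ... | d≡d′ , key≡ = label-injective s s′ d≡d′ (subst (λ k → key k (base s) ≡ key k (base s′)) (sym d≡d′) key≡)
    cover : ∀ L → Fam L → ∃[ s ] SameLine L (line s)
    cover L FamL with Fam-direction L FamL
    ... | k , L∥Eₖ with label-surjective k (key k (Line.base L))
    ... | s , refl , key≡ = s , λ x → ⇔-trans (hasDirection⇒stdLine (dir s) L L∥Eₖ x) (stdLine-cong (dir s) (sym key≡) x)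

module BinaryField (F : FiniteField) (n′ : ℕ) where
  open FieldTheory F
  open StandardPlane F n′

  module _ (binary : ∀ x → x ≡ 0# ⊎ x ≡ 1#) {B′ : ℕ} (e : Fin (suc B′) ↔ Vec Carrier n′)
           (e-zero : Inverse.to e zero ≡ replicate n′ 0#) where
    open Inverse e using (to; from; strictlyInverseˡ; strictlyInverseʳ)

    bit : Fin 2 → Carrier
    bit 0F = 0#
    bit 1F = 1#

    bit-injective : ∀ {b b′} → bit b ≡ bit b′ → b ≡ b′
    bit-injective {0F} {0F} _ = refl
    bit-injective {0F} {1F} 0≡1 = ⊥-elim (0≢1 0≡1)
    bit-injective {1F} {0F} 1≡0 = ⊥-elim (1≢0 1≡0)
    bit-injective {1F} {1F} _ = refl

    bit-surjective : ∀ x → ∃[ b ] bit b ≡ x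
    bit-surjective x with binary x
    ... | inj₁ x≡0 = 0F , sym x≡0
    ... | inj₂ x≡1 = 1F , sym x≡1

    -1≡1 : - 1# ≡ 1#
    -1≡1 with binary (- 1#)
    ... | inj₂ -1≡1 = -1≡1
    ... | inj₁ -1≡0 = ⊥-elim (1≢0 (trans (sym (-‿involutive 1#)) (trans (cong -_ -1≡0) -0#≈0#)))

    -- Over F₂ the plane with tail  to j  carries exactly six lines of the three directions;
    -- block j visits ∞₂, (0,0), ∞₃, (0,1), ∞₁, (1,0) there, and  value o  is σ on window o.
    direction : Fin 6 → Dir
    direction = lookup (D₂ ∷ D₃ ∷ D₃ ∷ D₁ ∷ D₁ ∷ D₂ ∷ [])

    corner : Fin 6 → Carrier × Carrier
    corner = lookup ((0# , 0#) ∷ (0# , 0#) ∷ (0# , 1#) ∷ (0# , 1#) ∷ (1# , 0#) ∷ (1# , 0#) ∷ [])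

    value : Fin 6 → Fin 2
    value = lookup (0F ∷ 0F ∷ 1F ∷ 1F ∷ 0F ∷ 1F ∷ [])

    base : Fin (suc B′) × Fin 6 → Pt
    base (j , o) = proj₁ (corner o) ∷ proj₂ (corner o) ∷ to j

    token : Fin (suc B′) × Fin 6 → PPt
    token (j , 0F) = inf (E D₂) (E-nonzero D₂)
    token (j , 1F) = aff (base (j , 1F))
    token (j , 2F) = inf (E D₃) (E-nonzero D₃)
    token (j , 3F) = aff (base (j , 3F))
    token (j , 4F) = inf (E D₁) (E-nonzero D₁)
    token (j , 5F) = aff (base (j , 5F))

    represents : ∀ s → Represents (token s) (token (nextSlot s)) (stdLine (direction (proj₂ s)) (base s))
    represents (j , 0F) = represents-inf-aff D₂ _
    represents (j , 1F) = represents-aff-inf D₃ _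
    represents (j , 2F) = represents-inf-aff D₃ _
    represents (j , 3F) = represents-aff-inf D₁ _
    represents (j , 4F) = represents-inf-aff D₁ _
    represents (j , 5F) = represents-aff-inf D₂ _

    σ-base : ∀ j o → σ (direction o) (base (j , o)) ≡ bit (value o)
    σ-base j 0F = refl
    σ-base j 1F = trans (+-identityˡ _) -0#≈0#
    σ-base j 2F = trans (+-identityˡ _) -1≡1
    σ-base j 3F = refl
    σ-base j 4F = refl
    σ-base j 5F = refl

    slot-injective : ∀ o o′ → direction o ≡ direction o′ → value o ≡ value o′ → o ≡ o′
    slot-injective = from-yes (all? λ o → all? λ o′ →
      (direction o ≟ᶠ direction o′) →-dec (value o ≟ᶠ value o′) →-dec (o ≟ᶠ o′))

    slot-surjective : ∀ k b → ∃[ o ] (direction o ≡ k × value o ≡ b)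
    slot-surjective = from-yes (all? λ k → all? λ b → any? λ o → (direction o ≟ᶠ k) ×-dec (value o ≟ᶠ b))

    schedule : StandardSchedule (blockOrder B′ 5)
    schedule = record
      { token = token
      ; dir = direction ∘ proj₂
      ; base = base
      ; represents = represents
      ; label-injective = λ (j , o) (j′ , o′) d≡d′ key≡ →
          let σ≡ , tail≡ = ,-injective key≡ in
          cong₂ _,_ (trans (sym (strictlyInverseʳ j)) (trans (cong from tail≡) (strictlyInverseʳ j′)))
            (slot-injective o o′ d≡d′ (bit-injective (begin
              bit (value o)                       ≡⟨ σ-base j o ⟨
              σ (direction o) (base (j , o))      ≡⟨ σ≡ ⟩
              σ (direction o) (base (j′ , o′))    ≡⟨ cong (λ k → σ k (base (j′ , o′))) d≡d′ ⟩
              σ (direction o′) (base (j′ , o′))   ≡⟨ σ-base j′ o′ ⟩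
              bit (value o′)                      ∎)))
      ; label-surjective = label-surjective
      ; visits-origin = (zero , 1F) , cong (λ r → aff (0# ∷ 0# ∷ r)) e-zero
      }
      where
      open ≡-Reasoning
      label-surjective : ∀ k ℓ → ∃[ s ] (direction (proj₂ s) ≡ k × key k (base s) ≡ ℓ)
      label-surjective k (x , r) with bit-surjective x
      ... | b , refl with slot-surjective k b
      ... | o , refl , refl = (from r , o) , refl , cong₂ _,_ (σ-base (from r) o) (strictlyInverseˡ r)

module TriangleField (F : FiniteField) (n′ : ℕ) where
  open FieldTheory F
  open StandardPlane F n′

  module _ {κ : Carrier} (κ≢0 : ¬ κ ≡ 0#) (κ≢1 : ¬ κ ≡ 1#) {B″ : ℕ}
           (e : Fin (suc (suc B″)) ↔ Vec Carrier (suc n′)) (e-zero : Inverse.to e zero ≡ replicate (suc n′) 0#) where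
    open Inverse e using (to; from; strictlyInverseˡ; strictlyInverseʳ)

    -- The triangle T(u), u = c ∷ r, has its side opposite  vertex k u  in direction E k,
    -- on the line with key (ι k c , r); as κ ∉ {0, 1} every ι k is a bijection, so each
    -- line of the family is a side of exactly one triangle.
    vertex : Dir → Vec Carrier (suc n′) → Pt
    vertex D₁ (c ∷ r) = κ * c ∷ c + 1# ∷ r
    vertex D₂ (c ∷ r) = κ * c - 1# ∷ c ∷ r
    vertex D₃ (c ∷ r) = κ * c ∷ c ∷ r

    slope intercept : Dir → Carrier
    slope D₁ = 1#
    slope D₂ = κ
    slope D₃ = κ - 1#
    intercept D₃ = - 1#
    intercept _ = 0#

    ι : Dir → Carrier → Carrier
    ι k c = slope k * c + intercept k

    slope≢0 : ∀ k → ¬ slope k ≡ 0#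
    slope≢0 D₁ = 1≢0
    slope≢0 D₂ = κ≢0
    slope≢0 D₃ κ-1≡0 = κ≢1 (begin
      κ               ≡⟨ solve 1 (λ κ → κ := κ :+ :- :1 :+ :1) refl κ ⟩
      κ - 1# + 1#     ≡⟨ cong (_+ 1#) κ-1≡0 ⟩
      0# + 1#         ≡⟨ +-identityˡ 1# ⟩
      1#              ∎)
      where open ≡-Reasoning

    vertex-key : ∀ x y → ¬ x ≡ y → ∀ u → key y (vertex x u) ≡ (ι y (head u) , tail u)
    vertex-key D₁ D₁ x≢y _ = ⊥-elim (x≢y refl)
    vertex-key D₂ D₂ x≢y _ = ⊥-elim (x≢y refl)
    vertex-key D₃ D₃ x≢y _ = ⊥-elim (x≢y refl)
    vertex-key D₂ D₁ _ (c ∷ r) = cong (_, r) (solve 1 (λ c → c := :1 :* c :+ :0) refl c)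
    vertex-key D₃ D₁ _ (c ∷ r) = cong (_, r) (solve 1 (λ c → c := :1 :* c :+ :0) refl c)
    vertex-key D₁ D₂ _ (c ∷ r) = cong (_, r) (solve 2 (λ κ c → κ :* c := κ :* c :+ :0) refl κ c)
    vertex-key D₃ D₂ _ (c ∷ r) = cong (_, r) (solve 2 (λ κ c → κ :* c := κ :* c :+ :0) refl κ c)
    vertex-key D₁ D₃ _ (c ∷ r) = cong (_, r) (solve 2 (λ κ c → κ :* c :+ :- (c :+ :1) := (κ :+ :- :1) :* c :+ :- :1) refl κ c)
    vertex-key D₂ D₃ _ (c ∷ r) = cong (_, r) (solve 2 (λ κ c → κ :* c :+ :- :1 :+ :- c := (κ :+ :- :1) :* c :+ :- :1) refl κ c)

    vertex-injective : ∀ x y u → vertex x u ≡ vertex y u → x ≡ y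
    vertex-injective D₁ D₁ _ _ = refl
    vertex-injective D₂ D₂ _ _ = refl
    vertex-injective D₃ D₃ _ _ = refl
    vertex-injective D₁ D₂ (c ∷ r) e = ⊥-elim (x+c≢x -1≢0 (sym (proj₁ (∷-injective e))))
    vertex-injective D₂ D₁ (c ∷ r) e = ⊥-elim (x+c≢x -1≢0 (proj₁ (∷-injective e)))
    vertex-injective D₁ D₃ (c ∷ r) e = ⊥-elim (x+c≢x 1≢0 (proj₁ (∷-injective (proj₂ (∷-injective e)))))
    vertex-injective D₃ D₁ (c ∷ r) e = ⊥-elim (x+c≢x 1≢0 (sym (proj₁ (∷-injective (proj₂ (∷-injective e))))))
    vertex-injective D₂ D₃ (c ∷ r) e = ⊥-elim (x+c≢x -1≢0 (proj₁ (∷-injective e)))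
    vertex-injective D₃ D₂ (c ∷ r) e = ⊥-elim (x+c≢x -1≢0 (sym (proj₁ (∷-injective e))))

    first last : Fin (suc (suc B″)) → Dir
    first j = hub (toℕ j)
    last j = first (next j)

    first≢last : ∀ j → ¬ first j ≡ last j
    first≢last j with view j
    ... | ‵inject₁ j′ rewrite next-inject₁ j′ | toℕ-inject₁ j′ = hub-step (toℕ j′)
    ... | ‵fromℕ rewrite next-fromℕ (suc B″) | toℕ-fromℕ B″ = alternate≢D₃ B″

    dir : Fin (suc (suc B″)) × Fin 3 → Dir
    dir (j , o) = slotDir (first j) (last j) o

    base : Fin (suc (suc B″)) × Fin 3 → Pt
    base (j , o) = vertex (slotCorner (first j) (last j) o) (to j)

    token : Fin (suc (suc B″)) × Fin 3 → PPt
    token (j , 0F) = inf (E (first j)) (E-nonzero (first j))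
    token (j , 1F) = aff (vertex (last j) (to j))
    token (j , 2F) = aff (vertex (first j) (to j))

    represents : ∀ s → Represents (token s) (token (nextSlot s)) (stdLine (dir s) (base s))
    represents (j , 0F) = represents-inf-aff (first j) _
    represents (j , 1F) = represents-aff-aff (third a b) (vertex b u) (vertex a u)
      (trans (vertex-key a (third a b) (third≢ˡ a b a≢b ∘ sym) u) (sym (vertex-key b (third a b) (third≢ʳ a b a≢b ∘ sym) u)))
      (a≢b ∘ vertex-injective a b u)
      where
      a = first j
      b = last j
      u = to j
      a≢b = first≢last j
    represents (j , 2F) = represents-aff-inf (last j) _

    key-base : ∀ s → key (dir s) (base s) ≡ (ι (dir s) (head (to (proj₁ s))) , tail (to (proj₁ s)))
    key-base (j , o) = vertex-key _ _ (slotDir≢slotCorner (first j) (last j) (first≢last j) o ∘ sym) (to j)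

    label-injective : ∀ s s′ → dir s ≡ dir s′ → key (dir s) (base s) ≡ key (dir s) (base s′) → s ≡ s′
    label-injective (j , o) (j′ , o′) d≡d′ key≡ = same-slot j≡j′ d≡d′
      where
      k = dir (j , o)
      k′ = dir (j′ , o′)
      u = to j
      u′ = to j′
      labels≡ : (ι k (head u) , tail u) ≡ (ι k (head u′) , tail u′)
      labels≡ = begin
        (ι k (head u) , tail u)       ≡⟨ key-base (j , o) ⟨
        key k (base (j , o))          ≡⟨ key≡ ⟩
        key k (base (j′ , o′))        ≡⟨ cong (λ k → key k (base (j′ , o′))) d≡d′ ⟩
        key k′ (base (j′ , o′))       ≡⟨ key-base (j′ , o′) ⟩
        (ι k′ (head u′) , tail u′)    ≡⟨ cong (λ k → ι k (head u′) , tail u′) d≡d′ ⟨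
        (ι k (head u′) , tail u′)     ∎
        where open ≡-Reasoning
      j≡j′ : j ≡ j′
      j≡j′ = let ι≡ , tail≡ = ,-injective labels≡ in
        trans (sym (strictlyInverseʳ j))
          (trans (cong from (head-tail-injective (affine-injective (intercept k) (slope≢0 k) ι≡) tail≡)) (strictlyInverseʳ j′))
      same-slot : j ≡ j′ → dir (j , o) ≡ dir (j′ , o′) → (j , o) ≡ (j′ , o′)
      same-slot refl d≡d′ = cong (j ,_) (slotDir-injective (first j) (last j) (first≢last j) o o′ d≡d′)

    label-surjective : ∀ k ℓ → ∃[ s ] (dir s ≡ k × key k (base s) ≡ ℓ)
    label-surjective k (v , r) = in-block (slotDir-surjective (first j) (last j) (first≢last j) k)
      where
      c = slope≢0 k ⁻¹ * (v - intercept k)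
      j = from (c ∷ r)
      in-block : ∃[ o ] dir (j , o) ≡ k → ∃[ s ] (dir s ≡ k × key k (base s) ≡ (v , r))
      in-block (o , dir≡k) = (j , o) , dir≡k , (begin
        key k (base (j , o))                              ≡⟨ cong (λ k → key k (base (j , o))) dir≡k ⟨
        key (dir (j , o)) (base (j , o))                  ≡⟨ key-base (j , o) ⟩
        (ι (dir (j , o)) (head (to j)) , tail (to j))
          ≡⟨ cong₂ (λ k u → ι k (head u) , tail u) dir≡k (strictlyInverseˡ (c ∷ r)) ⟩
        (ι k c , r)                                       ≡⟨ cong (_, r) (affine-surjective (intercept k) (slope≢0 k) v) ⟩
        (v , r)                                           ∎)
        where open ≡-Reasoning

    schedule : StandardSchedule (blockOrder (suc B″) 2)
    schedule = record
      { token = token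
      ; dir = dir
      ; base = base
      ; represents = represents
      ; label-injective = label-injective
      ; label-surjective = label-surjective
      ; visits-origin =
          (zero , 2F) , trans (cong (aff ∘ vertex D₃) e-zero) (cong (λ z → aff (z ∷ 0# ∷ replicate n′ 0#)) (zeroʳ κ))
      }

module Minors (F : FiniteField) (n : ℕ) where
  open FieldTheory F
  open AffineSpace F n

  minor : Pt → Pt → Fin n → Fin n → Carrier
  minor X Y i j = lookup X i * lookup Y j - lookup X j * lookup Y i

  minor-diagonal : ∀ X Y i → minor X Y i i ≡ 0#
  minor-diagonal X Y i = -‿inverseʳ _

  minor≢0⇒distinct : ∀ {X Y i j} → ¬ minor X Y i j ≡ 0# → ¬ j ≡ i
  minor≢0⇒distinct {X} {Y} {i} Δ≢0 refl = Δ≢0 (minor-diagonal X Y i)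

  nonzero-minor : ∀ {X Y} → NonZeroV X → NonZeroV Y → ¬ SameSpan X Y → ∃[ i ] ∃[ j ] ¬ minor X Y i j ≡ 0#
  nonzero-minor {X} {Y} X≢0 Y≢0 X≁Y = i , ¬∀⟶∃¬ n _ (λ j → minor X Y i j ≟ 0#) minors≡0⇒X∼Y
    where
    nonzero-coordinate : ∃[ i ] ¬ lookup X i ≡ 0#
    nonzero-coordinate = ¬∀⟶∃¬ n _ (λ i → lookup X i ≟ 0#) λ X≡0 →
      X≢0 (≡-by-lookup λ i → trans (X≡0 i) (sym (lookup-zeroV i)))
    i = proj₁ nonzero-coordinate
    Xᵢ≢0 = proj₂ nonzero-coordinate
    μ = lookup Y i * Xᵢ≢0 ⁻¹
    minors≡0⇒X∼Y : ¬ (∀ j → minor X Y i j ≡ 0#)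
    minors≡0⇒X∼Y minors≡0 = X≁Y (multiple⇒sameSpan μ Y≢0 (≡-by-lookup λ j → begin
      lookup Y j                               ≡⟨ *-cancelˡ Xᵢ≢0 (begin
        lookup X i * lookup Y j                    ≡⟨ x-y≡0⇒x≡y _ _ (minors≡0 j) ⟩
        lookup X j * lookup Y i                    ≡⟨ *-identityʳ _ ⟨
        lookup X j * lookup Y i * 1#               ≡⟨ cong (lookup X j * lookup Y i *_) (*-inverseʳ Xᵢ≢0) ⟨
        lookup X j * lookup Y i * (lookup X i * Xᵢ≢0 ⁻¹)
          ≡⟨ solve 4 (λ xi xj yi w → xj :* yi :* (xi :* w) := xi :* (yi :* w :* xj)) refl
                     (lookup X i) (lookup X j) (lookup Y i) (Xᵢ≢0 ⁻¹) ⟩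
        lookup X i * (μ * lookup X j)              ∎) ⟩
      μ * lookup X j                           ≡⟨ lookup-· μ X j ⟨
      lookup (μ · X) j                         ∎))
      where open ≡-Reasoning

-- X and Y together with the unit vectors off i and j form a basis; fromMap recovers the
-- X- and Y-coefficients by Cramer's rule.
module Completion (F : FiniteField) (n′ : ℕ) (X Y : Vec (FiniteField.Carrier F) (suc (suc n′)))
  (i j : Fin (suc (suc n′))) (Δ≢0 : ¬ Minors.minor F (suc (suc n′)) X Y i j ≡ FiniteField.0# F) where
  open FieldTheory F
  open StandardPlane F n′
  open Minors F (suc (suc n′))
  open LinearAutomorphisms F (suc (suc n′))
  private module Tail = AffineSpace F n′

  private
    j≢i = minor≢0⇒distinct {X} {Y} {i} {j} Δ≢0
    i′ = punchOut j≢i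
    Δ = minor X Y i j
    Δ⁻¹ = Δ≢0 ⁻¹

  embed : Vec Carrier n′ → Pt
  embed r = insertAt (insertAt r i′ 0#) j 0#

  project : Pt → Vec Carrier n′
  project x = removeAt (removeAt x j) i′

  embed-j : ∀ r → lookup (embed r) j ≡ 0#
  embed-j r = insertAt-lookup (insertAt r i′ 0#) j 0#

  embed-i : ∀ r → lookup (embed r) i ≡ 0#
  embed-i r = begin
    lookup (embed r) i                ≡⟨ cong (lookup (embed r)) (punchIn-punchOut j≢i) ⟨
    lookup (embed r) (punchIn j i′)   ≡⟨ insertAt-punchIn (insertAt r i′ 0#) j 0# i′ ⟩
    lookup (insertAt r i′ 0#) i′      ≡⟨ insertAt-lookup r i′ 0# ⟩
    0#                                ∎
    where open ≡-Reasoning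

  project-embed : ∀ r → project (embed r) ≡ r
  project-embed r = trans (cong (λ x → removeAt x i′) (removeAt-insertAt (insertAt r i′ 0#) j 0#)) (removeAt-insertAt r i′ 0#)

  embed-project : ∀ x → lookup x i ≡ 0# → lookup x j ≡ 0# → embed (project x) ≡ x
  embed-project x xᵢ≡0 xⱼ≡0 = begin
    insertAt (insertAt x″ i′ 0#) j 0#                            ≡⟨ cong (λ v → insertAt (insertAt x″ i′ v) j 0#) x′ᵢ′≡0 ⟨
    insertAt (insertAt x″ i′ (lookup x′ i′)) j 0#                 ≡⟨ cong (λ v → insertAt v j 0#) (insertAt-removeAt x′ i′) ⟩
    insertAt x′ j 0#                                              ≡⟨ cong (insertAt x′ j) xⱼ≡0 ⟨
    insertAt (removeAt x j) j (lookup x j)                        ≡⟨ insertAt-removeAt x j ⟩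
    x                                                             ∎
    where
    open ≡-Reasoning
    x′ = removeAt x j
    x″ = removeAt x′ i′
    x′ᵢ′≡0 : lookup x′ i′ ≡ 0#
    x′ᵢ′≡0 = trans (removeAt-punchOut x j≢i) xᵢ≡0

  embed-⊕ : ∀ r r′ → embed (r Tail.⊕ r′) ≡ embed r ⊕ embed r′
  embed-⊕ r r′ = begin
    insertAt (insertAt (r Tail.⊕ r′) i′ 0#) j 0#
      ≡⟨ cong₂ (λ a b → insertAt (insertAt (r Tail.⊕ r′) i′ a) j b) 0+0≡0 0+0≡0 ⟨
    insertAt (insertAt (r Tail.⊕ r′) i′ (0# + 0#)) j (0# + 0#)
      ≡⟨ cong (λ v → insertAt v j (0# + 0#)) (zipWith-insertAt _+_ r r′ i′ 0# 0#) ⟨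
    insertAt (zipWith _+_ (insertAt r i′ 0#) (insertAt r′ i′ 0#)) j (0# + 0#)
      ≡⟨ zipWith-insertAt _+_ (insertAt r i′ 0#) (insertAt r′ i′ 0#) j 0# 0# ⟨
    embed r ⊕ embed r′
      ∎
    where
    open ≡-Reasoning
    0+0≡0 = +-identityˡ 0#

  embed-· : ∀ c r → embed (c Tail.· r) ≡ c · embed r
  embed-· c r = begin
    insertAt (insertAt (c Tail.· r) i′ 0#) j 0#
      ≡⟨ cong₂ (λ a b → insertAt (insertAt (c Tail.· r) i′ a) j b) (zeroʳ c) (zeroʳ c) ⟨
    insertAt (insertAt (c Tail.· r) i′ (c * 0#)) j (c * 0#)
      ≡⟨ cong (λ v → insertAt v j (c * 0#)) (map-insertAt (c *_) 0# r i′) ⟨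
    insertAt (map (c *_) (insertAt r i′ 0#)) j (c * 0#)
      ≡⟨ map-insertAt (c *_) 0# (insertAt r i′ 0#) j ⟨
    c · embed r
      ∎
    where open ≡-Reasoning

  plane : Carrier → Carrier → Pt
  plane s t = (s · X) ⊕ (t · Y)

  lookup-plane : ∀ s t k → lookup (plane s t) k ≡ s * lookup X k + t * lookup Y k
  lookup-plane s t k = trans (lookup-⊕ (s · X) (t · Y) k) (cong₂ _+_ (lookup-· s X k) (lookup-· t Y k))

  coeffˣ coeffʸ : Pt → Carrier
  coeffˣ x = minor x Y i j * Δ⁻¹
  coeffʸ x = minor X x i j * Δ⁻¹

  cramer : ∀ s t w → lookup w i ≡ 0# → lookup w j ≡ 0# → coeffˣ (plane s t ⊕ w) ≡ s × coeffʸ (plane s t ⊕ w) ≡ t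
  cramer s t w wᵢ≡0 wⱼ≡0 = solved s (begin
      minor x Y i j                          ≡⟨ cong₂ (λ a b → a * Yⱼ - b * Yᵢ) (xₖ i wᵢ≡0) (xₖ j wⱼ≡0) ⟩
      (s * Xᵢ + t * Yᵢ) * Yⱼ - (s * Xⱼ + t * Yⱼ) * Yᵢ
        ≡⟨ solve 6 (λ s t Xᵢ Xⱼ Yᵢ Yⱼ → (s :* Xᵢ :+ t :* Yᵢ) :* Yⱼ :+ :- ((s :* Xⱼ :+ t :* Yⱼ) :* Yᵢ)
                                      := s :* (Xᵢ :* Yⱼ :+ :- (Xⱼ :* Yᵢ))) refl s t Xᵢ Xⱼ Yᵢ Yⱼ ⟩
      s * Δ                                  ∎)
    , solved t (begin
      minor X x i j                          ≡⟨ cong₂ (λ a b → Xᵢ * b - Xⱼ * a) (xₖ i wᵢ≡0) (xₖ j wⱼ≡0) ⟩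
      Xᵢ * (s * Xⱼ + t * Yⱼ) - Xⱼ * (s * Xᵢ + t * Yᵢ)
        ≡⟨ solve 6 (λ s t Xᵢ Xⱼ Yᵢ Yⱼ → Xᵢ :* (s :* Xⱼ :+ t :* Yⱼ) :+ :- (Xⱼ :* (s :* Xᵢ :+ t :* Yᵢ))
                                      := t :* (Xᵢ :* Yⱼ :+ :- (Xⱼ :* Yᵢ))) refl s t Xᵢ Xⱼ Yᵢ Yⱼ ⟩
      t * Δ                                  ∎)
    where
    open ≡-Reasoning
    x = plane s t ⊕ w
    Xᵢ = lookup X i
    Xⱼ = lookup X j
    Yᵢ = lookup Y i
    Yⱼ = lookup Y j
    xₖ : ∀ k → lookup w k ≡ 0# → lookup x k ≡ s * lookup X k + t * lookup Y k
    xₖ k wₖ≡0 = trans (lookup-⊕ (plane s t) w k) (trans (cong₂ _+_ (lookup-plane s t k) wₖ≡0) (+-identityʳ _))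
    solved : ∀ {m} c → m ≡ c * Δ → m * Δ⁻¹ ≡ c
    solved c m≡cΔ =
      trans (cong (_* Δ⁻¹) m≡cΔ) (trans (*-assoc c Δ _) (trans (cong (c *_) (*-inverseʳ Δ≢0)) (*-identityʳ c)))

  residual : Pt → Pt
  residual x = x ⊖ plane (coeffˣ x) (coeffʸ x)

  lookup-residual : ∀ x k → lookup (residual x) k ≡ lookup x k - (coeffˣ x * lookup X k + coeffʸ x * lookup Y k)
  lookup-residual x k = trans (lookup-⊖ x _ k) (cong (λ z → lookup x k - z) (lookup-plane (coeffˣ x) (coeffʸ x) k))

  residual-vanishes : ∀ x → lookup (residual x) i ≡ 0# × lookup (residual x) j ≡ 0#
  residual-vanishes x =
      (begin
        lookup (residual x) i  ≡⟨ lookup-residual x i ⟩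
        xᵢ - ((xᵢ * Yⱼ - xⱼ * Yᵢ) * Δ⁻¹ * Xᵢ + (Xᵢ * xⱼ - Xⱼ * xᵢ) * Δ⁻¹ * Yᵢ)
          ≡⟨ solve 7 (λ xᵢ xⱼ Xᵢ Xⱼ Yᵢ Yⱼ w → xᵢ :+ :- ((xᵢ :* Yⱼ :+ :- (xⱼ :* Yᵢ)) :* w :* Xᵢ
                                               :+ (Xᵢ :* xⱼ :+ :- (Xⱼ :* xᵢ)) :* w :* Yᵢ)
                        := xᵢ :+ :- ((Xᵢ :* Yⱼ :+ :- (Xⱼ :* Yᵢ)) :* w :* xᵢ)) refl xᵢ xⱼ Xᵢ Xⱼ Yᵢ Yⱼ Δ⁻¹ ⟩
        xᵢ - Δ * Δ⁻¹ * xᵢ      ≡⟨ x-1x≡0 xᵢ ⟩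
        0#                     ∎)
    , (begin
        lookup (residual x) j  ≡⟨ lookup-residual x j ⟩
        xⱼ - ((xᵢ * Yⱼ - xⱼ * Yᵢ) * Δ⁻¹ * Xⱼ + (Xᵢ * xⱼ - Xⱼ * xᵢ) * Δ⁻¹ * Yⱼ)
          ≡⟨ solve 7 (λ xᵢ xⱼ Xᵢ Xⱼ Yᵢ Yⱼ w → xⱼ :+ :- ((xᵢ :* Yⱼ :+ :- (xⱼ :* Yᵢ)) :* w :* Xⱼ
                                               :+ (Xᵢ :* xⱼ :+ :- (Xⱼ :* xᵢ)) :* w :* Yⱼ)
                        := xⱼ :+ :- ((Xᵢ :* Yⱼ :+ :- (Xⱼ :* Yᵢ)) :* w :* xⱼ)) refl xᵢ xⱼ Xᵢ Xⱼ Yᵢ Yⱼ Δ⁻¹ ⟩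
        xⱼ - Δ * Δ⁻¹ * xⱼ      ≡⟨ x-1x≡0 xⱼ ⟩
        0#                     ∎)
    where
    open ≡-Reasoning
    xᵢ = lookup x i
    xⱼ = lookup x j
    Xᵢ = lookup X i
    Xⱼ = lookup X j
    Yᵢ = lookup Y i
    Yⱼ = lookup Y j
    x-1x≡0 : ∀ z → z - Δ * Δ⁻¹ * z ≡ 0#
    x-1x≡0 z = trans (cong (λ c → z - c * z) (*-inverseʳ Δ≢0)) (trans (cong (λ c → z - c) (*-identityˡ z)) (-‿inverseʳ z))


  toMap : Pt → Pt
  toMap (s ∷ t ∷ r) = plane s t ⊕ embed r

  fromMap : Pt → Pt
  fromMap x = coeffˣ x ∷ coeffʸ x ∷ project (residual x)

  to-from : ∀ x → toMap (fromMap x) ≡ x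
  to-from x = let rᵢ≡0 , rⱼ≡0 = residual-vanishes x in
    trans (cong (plane (coeffˣ x) (coeffʸ x) ⊕_) (embed-project (residual x) rᵢ≡0 rⱼ≡0)) (⊕-⊖-inverse _ x)

  from-to : ∀ x → fromMap (toMap x) ≡ x
  from-to (s ∷ t ∷ r) = cong₂ _∷_ cˣ≡s (cong₂ _∷_ cʸ≡t (begin
    project (residual x)                  ≡⟨ cong project (cong₂ (λ a b → x ⊖ plane a b) cˣ≡s cʸ≡t) ⟩
    project (x ⊖ plane s t)               ≡⟨ cong project (⊕-⊖-cancel (plane s t) (embed r)) ⟩
    project (embed r)                     ≡⟨ project-embed r ⟩
    r                                     ∎))
    where
    open ≡-Reasoning
    x = plane s t ⊕ embed r
    cˣ≡s = proj₁ (cramer s t (embed r) (embed-i r) (embed-j r))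
    cʸ≡t = proj₂ (cramer s t (embed r) (embed-i r) (embed-j r))

  lookup-plane⊕ : ∀ s t w k → lookup (plane s t ⊕ w) k ≡ s * lookup X k + t * lookup Y k + lookup w k
  lookup-plane⊕ s t w k = trans (lookup-⊕ (plane s t) w k) (cong (_+ lookup w k) (lookup-plane s t k))

  to-⊕ : ∀ u v → toMap (u ⊕ v) ≡ toMap u ⊕ toMap v
  to-⊕ (s ∷ t ∷ r) (s′ ∷ t′ ∷ r′) = begin
    plane (s + s′) (t + t′) ⊕ embed (r Tail.⊕ r′)        ≡⟨ cong (plane (s + s′) (t + t′) ⊕_) (embed-⊕ r r′) ⟩
    plane (s + s′) (t + t′) ⊕ (embed r ⊕ embed r′)      ≡⟨ ≡-by-lookup pointwise ⟩
    (plane s t ⊕ embed r) ⊕ (plane s′ t′ ⊕ embed r′)   ∎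
    where
    open ≡-Reasoning
    pointwise : ∀ k → lookup (plane (s + s′) (t + t′) ⊕ (embed r ⊕ embed r′)) k
                    ≡ lookup ((plane s t ⊕ embed r) ⊕ (plane s′ t′ ⊕ embed r′)) k
    pointwise k = begin
      lookup (plane (s + s′) (t + t′) ⊕ (embed r ⊕ embed r′)) k
        ≡⟨ trans (lookup-plane⊕ _ _ _ k) (cong (_ +_) (lookup-⊕ (embed r) (embed r′) k)) ⟩
      (s + s′) * Xₖ + (t + t′) * Yₖ + (a + b)
        ≡⟨ solve 8 (λ s s′ t t′ Xₖ Yₖ a b → (s :+ s′) :* Xₖ :+ (t :+ t′) :* Yₖ :+ (a :+ b)
                                          := s :* Xₖ :+ t :* Yₖ :+ a :+ (s′ :* Xₖ :+ t′ :* Yₖ :+ b)) refl s s′ t t′ Xₖ Yₖ a b ⟩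
      (s * Xₖ + t * Yₖ + a) + (s′ * Xₖ + t′ * Yₖ + b)
        ≡⟨ trans (lookup-⊕ (plane s t ⊕ embed r) _ k)
                 (cong₂ _+_ (lookup-plane⊕ s t (embed r) k) (lookup-plane⊕ s′ t′ (embed r′) k)) ⟨
      lookup ((plane s t ⊕ embed r) ⊕ (plane s′ t′ ⊕ embed r′)) k ∎
      where
      Xₖ = lookup X k
      Yₖ = lookup Y k
      a = lookup (embed r) k
      b = lookup (embed r′) k

  to-· : ∀ c v → toMap (c · v) ≡ c · toMap v
  to-· c (s ∷ t ∷ r) = begin
    plane (c * s) (c * t) ⊕ embed (c Tail.· r)     ≡⟨ cong (plane (c * s) (c * t) ⊕_) (embed-· c r) ⟩
    plane (c * s) (c * t) ⊕ (c · embed r)          ≡⟨ ≡-by-lookup pointwise ⟩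
    c · (plane s t ⊕ embed r)                      ∎
    where
    open ≡-Reasoning
    pointwise : ∀ k → lookup (plane (c * s) (c * t) ⊕ (c · embed r)) k ≡ lookup (c · (plane s t ⊕ embed r)) k
    pointwise k = begin
      lookup (plane (c * s) (c * t) ⊕ (c · embed r)) k
        ≡⟨ trans (lookup-plane⊕ _ _ _ k) (cong (_ +_) (lookup-· c (embed r) k)) ⟩
      c * s * Xₖ + c * t * Yₖ + c * a
        ≡⟨ solve 6 (λ c s t Xₖ Yₖ a → c :* s :* Xₖ :+ c :* t :* Yₖ :+ c :* a
                                    := c :* (s :* Xₖ :+ t :* Yₖ :+ a)) refl c s t Xₖ Yₖ a ⟩
      c * (s * Xₖ + t * Yₖ + a)
        ≡⟨ trans (lookup-· c (plane s t ⊕ embed r) k) (cong (c *_) (lookup-plane⊕ s t (embed r) k)) ⟨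
      lookup (c · (plane s t ⊕ embed r)) k ∎
      where
      Xₖ = lookup X k
      Yₖ = lookup Y k
      a = lookup (embed r) k

  completion : LinearAutomorphism
  completion = record
    { to = toMap ; from = fromMap ; to-from = to-from ; from-to = from-to ; to-⊕ = to-⊕ ; to-· = to-· }

  toMap-plane : ∀ s t → toMap (s ∷ t ∷ Tail.zeroV) ≡ plane s t
  toMap-plane s t = trans (cong (plane s t ⊕_) embed-zero) (⊕-identityʳ (plane s t))
    where
    embed-zero : embed Tail.zeroV ≡ zeroV
    embed-zero = trans (cong (λ v → insertAt v j 0#) (insertAt-replicate i′)) (insertAt-replicate j)

  completion-E₁ : toMap (E D₁) ≡ X
  completion-E₁ = trans (toMap-plane 1# 0#) (trans (cong₂ _⊕_ (·-identityˡ X) (·-zeroˡ Y)) (⊕-identityʳ X))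

  completion-E₂ : toMap (E D₂) ≡ Y
  completion-E₂ = trans (toMap-plane 0# 1#) (trans (cong₂ _⊕_ (·-zeroˡ X) (·-identityˡ Y)) (⊕-identityˡ Y))

  completion-E₃ : toMap (E D₃) ≡ X ⊕ Y
  completion-E₃ = trans (toMap-plane 1# 1#) (cong₂ _⊕_ (·-identityˡ X) (·-identityˡ Y))

module Coplanarity (F : FiniteField) (n : ℕ) where
  open FieldTheory F
  open AffineSpace F n
  private
    module F² = AffineSpace F 2

  spanMap : Pt → Pt → Vec Carrier 2 → Pt
  spanMap u v (a ∷ b ∷ []) = (a · u) ⊕ (b · v)

  lookup-spanMap : ∀ u v a b k → lookup (spanMap u v (a ∷ b ∷ [])) k ≡ a * lookup u k + b * lookup v k
  lookup-spanMap u v a b k = trans (lookup-⊕ (a · u) (b · v) k) (cong₂ _+_ (lookup-· a u k) (lookup-· b v k))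

  spanMap-combination : ∀ u v α β c c′ →
    spanMap u v ((α F².· c) F².⊕ (β F².· c′)) ≡ (α · spanMap u v c) ⊕ (β · spanMap u v c′)
  spanMap-combination u v α β (a ∷ b ∷ []) (a′ ∷ b′ ∷ []) = ≡-by-lookup λ k → begin
    lookup (spanMap u v ((α * a + β * a′) ∷ (α * b + β * b′) ∷ [])) k
      ≡⟨ lookup-spanMap u v _ _ k ⟩
    (α * a + β * a′) * lookup u k + (α * b + β * b′) * lookup v k
      ≡⟨ solve 8 (λ α β a a′ b b′ uₖ vₖ → (α :* a :+ β :* a′) :* uₖ :+ (α :* b :+ β :* b′) :* vₖ
                                        := α :* (a :* uₖ :+ b :* vₖ) :+ β :* (a′ :* uₖ :+ b′ :* vₖ)) refl α β a a′ b b′ (lookup u k) (lookup v k) ⟩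
    α * (a * lookup u k + b * lookup v k) + β * (a′ * lookup u k + b′ * lookup v k)
      ≡⟨ trans (lookup-⊕ (α · w) (β · w′) k) (cong₂ _+_ (trans (lookup-· α w k) (cong (α *_) (lookup-spanMap u v a b k)))
                                                   (trans (lookup-· β w′ k) (cong (β *_) (lookup-spanMap u v a′ b′ k)))) ⟨
    lookup ((α · w) ⊕ (β · w′)) k ∎
    where
    open ≡-Reasoning
    w = spanMap u v (a ∷ b ∷ [])
    w′ = spanMap u v (a′ ∷ b′ ∷ [])

  spanMap-· : ∀ u v μ c → spanMap u v (μ F².· c) ≡ μ · spanMap u v c
  spanMap-· u v μ (a ∷ b ∷ []) = trans (cong₂ _⊕_ (sym (·-assoc μ a u)) (sym (·-assoc μ b v))) (sym (·-distribˡ-⊕ μ _ _))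

  spanMap-zero : ∀ u v → spanMap u v F².zeroV ≡ zeroV
  spanMap-zero u v = trans (cong₂ _⊕_ (·-zeroˡ u) (·-zeroˡ v)) (⊕-identityʳ zeroV)

  -- The coefficient vectors of d₁ and d₂ with respect to u, v are independent, hence
  -- a basis of F², which expresses the coefficients of d₃ through them.
  coplanar⇒combination : ∀ {d₁ d₂ d₃} → NonZeroV d₁ → NonZeroV d₂ → NonZeroV d₃ →
    ¬ SameSpan d₁ d₂ → ¬ SameSpan d₁ d₃ → ¬ SameSpan d₂ d₃ → Coplanar d₁ d₂ d₃ →
    ∃[ α ] ∃[ β ] (¬ α ≡ 0# × ¬ β ≡ 0# × d₃ ≡ (α · d₁) ⊕ (β · d₂))
  coplanar⇒combination {d₁} {d₂} {d₃} d₁≢0 d₂≢0 d₃≢0 d₁≁d₂ d₁≁d₃ d₂≁d₃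
                       (u , v , _ , (a₁ , b₁ , d₁≡) , (a₂ , b₂ , d₂≡) , (a₃ , b₃ , d₃≡)) =
    α , β , α≢0 , β≢0 , d₃≡αd₁+βd₂
    where
    c₁ c₂ c₃ : Vec Carrier 2
    c₁ = a₁ ∷ b₁ ∷ []
    c₂ = a₂ ∷ b₂ ∷ []
    c₃ = a₃ ∷ b₃ ∷ []
    c≢0 : ∀ {d c} → NonZeroV d → d ≡ spanMap u v c → F².NonZeroV c
    c≢0 d≢0 d≡ c≡0 = d≢0 (trans d≡ (trans (cong (spanMap u v) c≡0) (spanMap-zero u v)))
    c₁≁c₂ : ¬ F².SameSpan c₁ c₂
    c₁≁c₂ c₁~c₂ with F².sameSpan⇒multiple (c≢0 d₁≢0 d₁≡) c₁~c₂
    ... | μ , _ , c₁≡μc₂ = d₁≁d₂ (sameSpan-sym (multiple⇒sameSpan μ d₁≢0 (begin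
      d₁                   ≡⟨ d₁≡ ⟩
      spanMap u v c₁       ≡⟨ cong (spanMap u v) c₁≡μc₂ ⟩
      spanMap u v (μ F².· c₂) ≡⟨ spanMap-· u v μ c₂ ⟩
      μ · spanMap u v c₂   ≡⟨ cong (μ ·_) d₂≡ ⟨
      μ · d₂               ∎)))
      where open ≡-Reasoning
    minor≢0 = Minors.nonzero-minor F 2 (c≢0 d₁≢0 d₁≡) (c≢0 d₂≢0 d₂≡) c₁≁c₂
    i = proj₁ minor≢0
    j = proj₁ (proj₂ minor≢0)
    Δ≢0 = proj₂ (proj₂ minor≢0)
    open Completion F 0 c₁ c₂ i j Δ≢0 using (toMap; fromMap; to-from; toMap-plane; coeffˣ; coeffʸ)
    α = coeffˣ c₃
    β = coeffʸ c₃
    c₃≡αc₁+βc₂ : c₃ ≡ (α F².· c₁) F².⊕ (β F².· c₂)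
    c₃≡αc₁+βc₂ = begin
      c₃                          ≡⟨ to-from c₃ ⟨
      toMap (fromMap c₃)          ≡⟨ cong (λ r → toMap (α ∷ β ∷ r)) (vec0 _) ⟩
      toMap (α ∷ β ∷ [])          ≡⟨ toMap-plane α β ⟩
      (α F².· c₁) F².⊕ (β F².· c₂) ∎
      where
      open ≡-Reasoning
      vec0 : (r : Vec Carrier 0) → r ≡ []
      vec0 [] = refl
    d₃≡αd₁+βd₂ : d₃ ≡ (α · d₁) ⊕ (β · d₂)
    d₃≡αd₁+βd₂ = begin
      d₃                                          ≡⟨ d₃≡ ⟩
      spanMap u v c₃                              ≡⟨ cong (spanMap u v) c₃≡αc₁+βc₂ ⟩
      spanMap u v ((α F².· c₁) F².⊕ (β F².· c₂))  ≡⟨ spanMap-combination u v α β c₁ c₂ ⟩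
      (α · spanMap u v c₁) ⊕ (β · spanMap u v c₂) ≡⟨ cong₂ (λ x y → (α · x) ⊕ (β · y)) d₁≡ d₂≡ ⟨
      (α · d₁) ⊕ (β · d₂)                         ∎
      where open ≡-Reasoning
    α≢0 : ¬ α ≡ 0#
    α≢0 α≡0 = d₂≁d₃ (multiple⇒sameSpan β d₃≢0 (trans d₃≡αd₁+βd₂
      (trans (cong (λ a → (a · d₁) ⊕ (β · d₂)) α≡0) (trans (cong (_⊕ (β · d₂)) (·-zeroˡ d₁)) (⊕-identityˡ _)))))
    β≢0 : ¬ β ≡ 0#
    β≢0 β≡0 = d₁≁d₃ (multiple⇒sameSpan α d₃≢0 (trans d₃≡αd₁+βd₂
      (trans (cong (λ b → (α · d₁) ⊕ (b · d₂)) β≡0) (trans (cong ((α · d₁) ⊕_) (·-zeroˡ d₂)) (⊕-identityʳ _)))))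

module StandardCase (F : FiniteField) (n′ : ℕ) where
  open FieldTheory F
  open StandardPlane F n′
  open Enumerations F

  standardUniversalCycle : Σ (UniversalCycle Fam) ContainsZero
  standardUniversalCycle with any? (λ a → ¬? (from a ≟ 0#) ×-dec ¬? (from a ≟ 1#))
    where open Inverse enum using (from)
  ... | yes (a , κ≢0 , κ≢1) =
    let B″ , e , e-zero = centredEnumeration⁺ n′ in standardCycle (TriangleField.schedule F n′ κ≢0 κ≢1 e e-zero)
  ... | no no-third-element =
    let B′ , e , e-zero = centredEnumeration n′ in standardCycle (BinaryField.schedule F n′ binary e e-zero)
    where
    open Inverse enum using (to; from; strictlyInverseʳ)
    binary : ∀ x → x ≡ 0# ⊎ x ≡ 1#
    binary x with x ≟ 0# | x ≟ 1#
    ... | yes x≡0 | _ = inj₁ x≡0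
    ... | no _ | yes x≡1 = inj₂ x≡1
    ... | no x≢0 | no x≢1 = ⊥-elim (no-third-element (to x , subst (λ y → ¬ y ≡ 0#) (sym (strictlyInverseʳ x)) x≢0
                                                             , subst (λ y → ¬ y ≡ 1#) (sym (strictlyInverseʳ x)) x≢1))

mainTheorem3 : (F : FiniteField) (n : ℕ) → 2 ≤ n →
    let open Geometry F n in
    (d₁ d₂ d₃ : Pt) → NonZeroV d₁ → NonZeroV d₂ → NonZeroV d₃ →
    ¬ SameSpan d₁ d₂ → ¬ SameSpan d₁ d₃ → ¬ SameSpan d₂ d₃ →
    Coplanar d₁ d₂ d₃ →
    Σ (UniversalCycle (Fam3 d₁ d₂ d₃)) ContainsZero
mainTheorem3 F (suc (suc n′)) (s≤s (s≤s z≤n)) d₁ d₂ d₃ d₁≢0 d₂≢0 d₃≢0 d₁≁d₂ d₁≁d₃ d₂≁d₃ coplanar =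
  let α , β , α≢0 , β≢0 , d₃≡αd₁+βd₂ = coplanar⇒combination d₁≢0 d₂≢0 d₃≢0 d₁≁d₂ d₁≁d₃ d₂≁d₃ coplanar
      αd₁~d₁ = ·-sameSpan α≢0 d₁≢0
      βd₂~d₂ = ·-sameSpan β≢0 d₂≢0
      αd₁≁βd₂ = λ αd₁~βd₂ → d₁≁d₂ (sameSpan-trans (sameSpan-sym αd₁~d₁) (sameSpan-trans αd₁~βd₂ βd₂~d₂))
      i , j , Δ≢0 = nonzero-minor (·-nonzero α≢0 d₁≢0) (·-nonzero β≢0 d₂≢0) αd₁≁βd₂
      open Completion F n′ (α · d₁) (β · d₂) i j Δ≢0
  in transport-Fam3 completion
       (subst (λ x → SameSpan x d₁) (sym completion-E₁) αd₁~d₁)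
       (subst (λ x → SameSpan x d₂) (sym completion-E₂) βd₂~d₂)
       (subst (λ x → SameSpan x d₃) (sym (trans completion-E₃ (sym d₃≡αd₁+βd₂))) (λ _ → ⇔-refl))
       (StandardCase.standardUniversalCycle F n′)
  where
  open FieldTheory F
  open StandardPlane F n′
  open LinearAutomorphisms F (suc (suc n′))
  open Coplanarity F (suc (suc n′))
  open Minors F (suc (suc n′))
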